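{- Let $\mathcal{P}$ be a finite bounded extremal poset with least element $\hat0$, greatest element $\hat1$ and $\ell(\mathcal{P})=k$. Then the $m$-cover poset $\mathcal{P}^{\langle m\rangle}$ is extremal for every $m>0$ if and only if either ($\hat{0}\in\mathrm{M}(\mathcal{P})$ and $\hat{1}\in\mathrm{J}(\mathcal{P})$) or ($\hat{0}\notin\mathrm{M}(\mathcal{P})$ and $\hat{1}\notin\mathrm{J}(\mathcal{P})$).
   Context: The $m$-cover poset $\mathcal{P}^{\langle m\rangle}$ is the subposet of the componentwise-ordered direct product $\mathcal{P}^m$ consisting of the multichains $x_1\le\cdots\le x_m$ of $\mathcal P$ such that $\{x_1,\dots,x_m\}\setminus\{\hat0\}$ is empty, a single element, or $\{p,q\}$ with $p\lessdot q$. $\mathrm{J}(\mathcal Q)$ is the set of join-irreducible elements (not minimal, exactly one lower cover) and $\mathrm{M}(\mathcal Q)$ the set of meet-irreducible elements (not maximal, exactly one upper cover). The length $\ell$ is the maximal number of covers in a saturated chain from least to greatest element. A bounded poset $\mathcal Q$ is extremal if $|\mathrm{J}(\mathcal Q)|=\ell(\mathcal Q)=|\mathrm{M}(\mathcal Q)|$. -}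

module Defs where

open import Data.Nat using (ℕ; zero; suc; _≤_)
open import Data.Fin using (Fin; toℕ)
open import Data.Vec using (Vec; lookup)
open import Data.List using (List; length)
open import Data.List.Membership.Propositional using (_∈_)
open import Data.List.Relation.Unary.Unique.Propositional using (Unique)
open import Data.Product using (Σ; ∃; ∃-syntax; _×_; _,_)
open import Data.Sum using (_⊎_)
open import Data.Unit using (⊤)
open import Relation.Nullary using (¬_; Dec)
open import Relation.Binary.PropositionalEquality using (_≡_; _≢_)

-- A "poset on a subset": an ambient type A, a predicate Elem cutting out
-- the elements, and an order relation.  All notions below quantify only
-- over elements satisfying Elem.

record SubPoset : Set₁ where
  field
    A    : Set
    Elem : A → Set
    _≼_  : A → A → Set

module _ (Q : SubPoset) where
  open SubPoset Q

  _≺_ : A → A → Set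
  x ≺ y = x ≼ y × x ≢ y

  Covers : A → A → Set
  Covers x y = Elem x × Elem y × x ≺ y × (∀ z → Elem z → x ≺ z → ¬ (z ≺ y))

  Minimal : A → Set
  Minimal x = Elem x × (∀ y → Elem y → ¬ (y ≺ x))

  Maximal : A → Set
  Maximal x = Elem x × (∀ y → Elem y → ¬ (x ≺ y))

  JoinIrr : A → Set
  JoinIrr x = Elem x × ¬ Minimal x
            × (∃[ y ] (Covers y x × (∀ z → Covers z x → z ≡ y)))

  MeetIrr : A → Set
  MeetIrr x = Elem x × ¬ Maximal x
            × (∃[ y ] (Covers x y × (∀ z → Covers x z → z ≡ y)))

  Least : A → Set
  Least b = Elem b × (∀ x → Elem x → b ≼ x)

  Greatest : A → Set
  Greatest t = Elem t × (∀ x → Elem x → x ≼ t)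

  data SatChain : A → A → ℕ → Set where
    done : ∀ {x} → Elem x → SatChain x x zero
    step : ∀ {x y z k} → Covers x y → SatChain y z k → SatChain x z (suc k)

  HasLength : ℕ → Set
  HasLength k =
    (∃[ b ] ∃[ t ] (Least b × Greatest t × SatChain b t k))
    × (∀ b t j → Least b → Greatest t → SatChain b t j → j ≤ k)

  Card : (A → Set) → ℕ → Set
  Card S c = ∃[ xs ] (Unique xs × length xs ≡ c
                      × (∀ x → (x ∈ xs → S x) × (S x → x ∈ xs)))

  Extremal : Set
  Extremal = ∃[ k ] (HasLength k × Card JoinIrr k × Card MeetIrr k)

record FinBoundedPoset : Set₁ where
  field
    Carrier   : Set
    _≤P_      : Carrier → Carrier → Set
    ≤-refl    : ∀ x → x ≤P x
    ≤-antisym : ∀ {x y} → x ≤P y → y ≤P x → x ≡ y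
    ≤-trans   : ∀ {x y z} → x ≤P y → y ≤P z → x ≤P z
    _≤?_      : ∀ x y → Dec (x ≤P y)
    _≟_       : ∀ (x y : Carrier) → Dec (x ≡ y)
    elems     : List Carrier
    complete  : ∀ x → x ∈ elems
    𝟘         : Carrier
    𝟙         : Carrier
    𝟘-least   : ∀ x → 𝟘 ≤P x
    𝟙-greatest : ∀ x → x ≤P 𝟙

asSub : FinBoundedPoset → SubPoset
asSub P = record { A = FinBoundedPoset.Carrier P ; Elem = λ _ → ⊤
                 ; _≼_ = FinBoundedPoset._≤P_ P }

module _ (P : FinBoundedPoset) (m : ℕ) where
  open FinBoundedPoset P

  InNonzero : Vec Carrier m → Carrier → Set
  InNonzero v x = x ≢ 𝟘 × ∃[ i ] (lookup v i ≡ x)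

  Multichain : Vec Carrier m → Set
  Multichain v = ∀ (i j : Fin m) → toℕ i ≤ toℕ j → lookup v i ≤P lookup v j

  CoverCond : Vec Carrier m → Set
  CoverCond v =
      (∀ x → ¬ InNonzero v x)
    ⊎ (∃[ p ] (InNonzero v p × (∀ x → InNonzero v x → x ≡ p)))
    ⊎ (∃[ p ] ∃[ q ] (Covers (asSub P) p q × InNonzero v p × InNonzero v q
                      × (∀ x → InNonzero v x → x ≡ p ⊎ x ≡ q)))

  MCover : SubPoset
  MCover = record
    { A    = Vec Carrier m
    ; Elem = λ v → Multichain v × CoverCond v
    ; _≼_  = λ u v → ∀ i → lookup u i ≤P lookup v i
    }

-- The constant vectors give P^⟨m⟩ length m·k, and its join-irreducibles are exactly the
-- vectors 𝟘^a j^(m−a) (a < m, j ∈ J(P)), so |J(P^⟨m⟩)| = m·k for every m. Its meet-irreducibles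
-- are x^(a+1) x⁺^(m−a−1) for x ∈ M(P) ∖ {𝟘} with unique upper cover x⁺, the vector 𝟘^m when
-- 𝟘 ∈ M(P), and 𝟘^(a+1) 𝟙^(m−a−1) (a < m−1) when 𝟙 ∈ J(P). Hence
-- |M(P^⟨m⟩)| = m·k − (m−1)·[𝟘 ∈ M(P)] + (m−1)·[𝟙 ∈ J(P)], which is m·k for all m > 0 exactly
-- when the two conditions hold simultaneously or fail simultaneously.

module Submission where

open import Defs
open import Data.Nat using (ℕ; _>_)
open import Data.Product using (_×_)
open import Data.Sum using (_⊎_)
open import Relation.Nullary using (¬_)
open import Function.Bundles using (_⇔_)

open import Data.Nat using (zero; suc; _+_; _*_; _∸_; _≤_; _<_; z≤n; s≤s)
import Data.Nat.Properties as ℕ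
open import Algebra.Properties.CommutativeMonoid.Sum ℕ.+-0-commutativeMonoid using (sum; ∑-distrib-+)
open import Data.Nat.Tactic.RingSolver using (solve-∀)
open import Data.Fin using (Fin; toℕ; fromℕ<; inject₁)
import Data.Fin.Properties as Fin
open import Data.Vec using (Vec; lookup; tabulate; _[_]≔_)
open import Data.Vec.Properties using (lookup∘tabulate; lookup∘update; lookup∘update′; tabulate∘lookup; tabulate-cong)
import Data.Vec.Properties as Vec
open import Data.List using (List; []; _∷_; length; map; _++_; allFin; filter; cartesianProduct)
open import Data.List.Properties using (length-++; length-map; length-tabulate)
open import Data.List.Membership.Propositional using (_∈_)
import Data.List.Membership.DecPropositional as DecMembership
open import Data.List.Membership.Propositional.Properties
  using (∈-map⁺; ∈-map⁻; ∈-++⁺ˡ; ∈-++⁺ʳ; ∈-++⁻; ∈-allFin; ∈-filter⁺; ∈-filter⁻; ∈-cartesianProduct⁺; ∈-cartesianProduct⁻)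
open import Data.List.Membership.Propositional.Properties.WithK using (unique∧set⇒bag)
open import Data.List.Relation.Unary.Unique.Propositional using (Unique)
import Data.List.Relation.Unary.Unique.Propositional.Properties as Unique
open import Data.List.Relation.Unary.All as All using (All; []; _∷_; all?)
open import Data.List.Relation.Unary.AllPairs using ([]; _∷_)
open import Data.List.Relation.Unary.Any as Any using (here; there; any?)
open import Data.List.Relation.Binary.BagAndSetEquality using (∼bag⇒↭)
open import Data.List.Relation.Binary.Permutation.Propositional.Properties using (↭-length)
open import Data.Product using (∃; ∃-syntax; _,_; proj₁; proj₂)
open import Data.Sum using (inj₁; inj₂; [_,_]′)
open import Data.Unit using (⊤; tt)
open import Data.Empty using (⊥; ⊥-elim)
open import Function using (_∘_)
open import Function.Bundles using (mk⇔; Equivalence)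
open import Relation.Nullary using (Dec; yes; no; ¬?; _×-dec_; _→-dec_)
open import Relation.Binary.Definitions using (tri<; tri≈; tri>)
open import Relation.Binary.PropositionalEquality using (_≡_; _≢_; refl; sym; trans; cong; cong₂; subst; subst₂)
open Relation.Binary.PropositionalEquality.≡-Reasoning


HasCard : {A : Set} → (A → Set) → ℕ → Set
HasCard {A} S c = ∃[ xs ] (Unique xs × length xs ≡ c × (∀ (x : A) → (x ∈ xs → S x) × (S x → x ∈ xs)))

indicator : {A : Set} → Dec A → ℕ
indicator (yes _) = 1
indicator (no _) = 0

module _ {A : Set} where

  hasCard-cong : ∀ {S T : A → Set} {c} → (∀ x → S x → T x) → (∀ x → T x → S x) →
                 HasCard S c → HasCard T c
  hasCard-cong S⇒T T⇒S (xs , xs! , len , mem) =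
    xs , xs! , len , λ x → (λ x∈ → S⇒T x (proj₁ (mem x) x∈)) , (λ t → proj₂ (mem x) (T⇒S x t))

  hasCard-unique : ∀ {S : A → Set} {a b} → HasCard S a → HasCard S b → a ≡ b
  hasCard-unique (xs , xs! , refl , mem) (ys , ys! , refl , mem′) =
    ↭-length (∼bag⇒↭ (unique∧set⇒bag xs! ys! (λ {x} →
      mk⇔ (λ x∈ → proj₂ (mem′ x) (proj₁ (mem x) x∈)) (λ x∈ → proj₂ (mem x) (proj₁ (mem′ x) x∈)))))

  hasCard-∅ : ∀ {S : A → Set} → (∀ x → ¬ S x) → HasCard S 0
  hasCard-∅ ¬S = [] , [] , refl , λ x → (λ ()) , (λ s → ⊥-elim (¬S x s))

  hasCard-singleton : ∀ {S : A → Set} x → S x → (∀ y → S y → y ≡ x) → HasCard S 1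
  hasCard-singleton x s only = (x ∷ []) , ([] ∷ []) , refl ,
    λ y → (λ { (here refl) → s }) , (λ sy → here (only y sy))

  hasCard-⊎ : ∀ {S T : A → Set} {a b} → HasCard S a → HasCard T b → (∀ x → S x → ¬ T x) →
              HasCard (λ x → S x ⊎ T x) (a + b)
  hasCard-⊎ (xs , xs! , refl , mem) (ys , ys! , refl , mem′) disjoint =
    xs ++ ys ,
    Unique.++⁺ xs! ys! (λ (x∈xs , x∈ys) → disjoint _ (proj₁ (mem _) x∈xs) (proj₁ (mem′ _) x∈ys)) ,
    length-++ xs ,
    λ x → (λ x∈ → Data.Sum.map (proj₁ (mem x)) (proj₁ (mem′ x)) (∈-++⁻ xs x∈)) ,
          (λ { (inj₁ s) → ∈-++⁺ˡ (proj₂ (mem x) s) ; (inj₂ t) → ∈-++⁺ʳ xs (proj₂ (mem′ x) t) })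

  hasCard-dec : ∀ {S : A → Set} {c} → ((x y : A) → Dec (x ≡ y)) → HasCard S c → ∀ x → Dec (S x)
  hasCard-dec _≟_ (xs , _ , _ , mem) x with DecMembership._∈?_ _≟_ x xs
  ... | yes x∈ = yes (proj₁ (mem x) x∈)
  ... | no x∉ = no (λ s → x∉ (proj₂ (mem x) s))

  hasCard-at : ∀ {S : A → Set} x (d : Dec (S x)) → HasCard (λ y → S y × y ≡ x) (indicator d)
  hasCard-at x (yes s) = hasCard-singleton x (s , refl) (λ y → proj₂)
  hasCard-at x (no ¬s) = hasCard-∅ (λ { y (s , refl) → ¬s s })

  -- The size of the rest is read off from uniqueness of cardinality, not computed.
  hasCard-remove : ∀ {S : A → Set} {c} → ((x y : A) → Dec (x ≡ y)) → ∀ x (d : Dec (S x)) →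
                   HasCard S c → ∃[ c′ ] (HasCard (λ y → S y × y ≢ x) c′ × c′ + indicator d ≡ c)
  hasCard-remove {S} _≟_ x d card@(xs , xs! , _ , mem) =
    length rest , rest-card ,
    hasCard-unique (hasCard-cong recombine split (hasCard-⊎ rest-card (hasCard-at x d) apart)) card
    where
    rest : List A
    rest = filter (λ y → ¬? (y ≟ x)) xs
    rest-card : HasCard (λ y → S y × y ≢ x) (length rest)
    rest-card = rest , Unique.filter⁺ _ xs! , refl ,
      λ y → (λ y∈ → let y∈xs , y≢x = ∈-filter⁻ _ y∈ in proj₁ (mem y) y∈xs , y≢x) ,
            (λ (s , y≢x) → ∈-filter⁺ _ (proj₂ (mem y) s) y≢x)
    apart : ∀ y → S y × y ≢ x → ¬ (S y × y ≡ x)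
    apart y (_ , y≢x) (_ , y≡x) = y≢x y≡x
    recombine : ∀ y → (S y × y ≢ x) ⊎ (S y × y ≡ x) → S y
    recombine y (inj₁ (s , _)) = s
    recombine y (inj₂ (s , _)) = s
    split : ∀ y → S y → (S y × y ≢ x) ⊎ (S y × y ≡ x)
    split y s with y ≟ x
    ... | yes y≡x = inj₂ (s , y≡x)
    ... | no y≢x = inj₁ (s , y≢x)

length-cartesianProduct : ∀ {A B : Set} (xs : List A) (ys : List B) →
                          length (cartesianProduct xs ys) ≡ length xs * length ys
length-cartesianProduct [] ys = refl
length-cartesianProduct (x ∷ xs) ys = begin
  length (map (x ,_) ys ++ cartesianProduct xs ys)         ≡⟨ length-++ (map (x ,_) ys) ⟩
  length (map (x ,_) ys) + length (cartesianProduct xs ys) ≡⟨ cong₂ _+_ (length-map (x ,_) ys) (length-cartesianProduct xs ys) ⟩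
  length ys + length xs * length ys                        ∎

hasCard-× : ∀ {A B : Set} {S : A → Set} {T : B → Set} {a b} → HasCard S a → HasCard T b →
            HasCard (λ (x , y) → S x × T y) (a * b)
hasCard-× (xs , xs! , refl , mem) (ys , ys! , refl , mem′) =
  cartesianProduct xs ys , Unique.cartesianProduct⁺ xs! ys! , length-cartesianProduct xs ys ,
  λ (x , y) → (λ xy∈ → let x∈ , y∈ = ∈-cartesianProduct⁻ xs ys xy∈ in proj₁ (mem x) x∈ , proj₁ (mem′ y) y∈) ,
              (λ (s , t) → ∈-cartesianProduct⁺ (proj₂ (mem x) s) (proj₂ (mem′ y) t))

hasCard-Fin : ∀ n → HasCard {Fin n} (λ _ → ⊤) n
hasCard-Fin n = allFin n , Unique.allFin⁺ n , length-tabulate (λ i → i) ,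
  λ i → (λ _ → tt) , (λ _ → ∈-allFin i)

module _ {A B : Set} (g : A → B) {S : A → Set} (injectiveOn : ∀ {x y} → S x → S y → g x ≡ g y → x ≡ y) where

  private
    map-unique : ∀ {xs} → All S xs → Unique xs → Unique (map g xs)
    map-unique [] [] = []
    map-unique {x ∷ xs} (sx ∷ sxs) (x∉ ∷ xs!) = apart sxs x∉ ∷ map-unique sxs xs!
      where
      apart : ∀ {ys} → All S ys → All (x ≢_) ys → All (g x ≢_) (map g ys)
      apart [] [] = []
      apart (sy ∷ sys) (x≢y ∷ x≢ys) = (λ gx≡gy → x≢y (injectiveOn sx sy gx≡gy)) ∷ apart sys x≢ys

  hasCard-image : ∀ {c} → HasCard S c → HasCard (λ b → ∃[ x ] (S x × b ≡ g x)) c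
  hasCard-image (xs , xs! , refl , mem) =
    map g xs , map-unique (All.tabulate (λ {x} x∈ → proj₁ (mem x) x∈)) xs! , length-map g xs ,
    λ b → (λ b∈ → let x , x∈ , b≡ = ∈-map⁻ g b∈ in x , proj₁ (mem x) x∈ , b≡) ,
          (λ { (x , s , refl) → ∈-map⁺ g (proj₂ (mem x) s) })

hasCard-image₂ : ∀ {A B : Set} {r} (g : A → Fin r → B) {S : A → Set} →
                 (∀ {x y i j} → S x → S y → g x i ≡ g y j → x ≡ y × i ≡ j) →
                 ∀ {c} → HasCard S c → HasCard (λ b → ∃[ x ] ∃[ i ] (S x × b ≡ g x i)) (c * r)
hasCard-image₂ {r = r} g {S} injectiveOn card =
  hasCard-cong (λ { b ((x , i) , (s , _) , b≡) → x , i , s , b≡ }) (λ { b (x , i , s , b≡) → (x , i) , (s , tt) , b≡ })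
    (hasCard-image (λ (x , i) → g x i) pair-injective (hasCard-× card (hasCard-Fin r)))
  where
  pair-injective : ∀ {p q} → S (proj₁ p) × ⊤ → S (proj₁ q) × ⊤ → g (proj₁ p) (proj₂ p) ≡ g (proj₁ q) (proj₂ q) → p ≡ q
  pair-injective (sx , _) (sy , _) eq with injectiveOn sx sy eq
  ... | refl , refl = refl

module _ {A B : Set} where

  indicator-≡⇒both-or-neither : (a? : Dec A) (b? : Dec B) → indicator a? ≡ indicator b? → (A × B) ⊎ (¬ A × ¬ B)
  indicator-≡⇒both-or-neither (yes a) (yes b) _ = inj₁ (a , b)
  indicator-≡⇒both-or-neither (no ¬a) (no ¬b) _ = inj₂ (¬a , ¬b)

  both-or-neither⇒indicator-≡ : (a? : Dec A) (b? : Dec B) → (A × B) ⊎ (¬ A × ¬ B) → indicator a? ≡ indicator b?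
  both-or-neither⇒indicator-≡ (yes _) (yes _) _ = refl
  both-or-neither⇒indicator-≡ (no _) (no _) _ = refl
  both-or-neither⇒indicator-≡ (yes a) (no _) (inj₂ (¬a , _)) = ⊥-elim (¬a a)
  both-or-neither⇒indicator-≡ (yes _) (no ¬b) (inj₁ (_ , b)) = ⊥-elim (¬b b)
  both-or-neither⇒indicator-≡ (no ¬a) (yes _) (inj₁ (a , _)) = ⊥-elim (¬a a)
  both-or-neither⇒indicator-≡ (no _) (yes b) (inj₂ (_ , ¬b)) = ⊥-elim (¬b b)

module _ (S : SubPoset) where

  hasLength-unique : ∀ {k k′} → HasLength S k → HasLength S k′ → k ≡ k′
  hasLength-unique ((b , t , b-least , t-greatest , chain) , bound) ((b′ , t′ , b′-least , t′-greatest , chain′) , bound′) =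
    ℕ.≤-antisym (bound′ b t _ b-least t-greatest chain) (bound b′ t′ _ b′-least t′-greatest chain′)

module _ {S : SubPoset} where

  _++ˢ_ : ∀ {x y z i j} → SatChain S x y i → SatChain S y z j → SatChain S x z (i + j)
  done _ ++ˢ chain′ = chain′
  step x⋖y chain ++ˢ chain′ = step x⋖y (chain ++ˢ chain′)

-- In a subposet with a strictly monotone ℕ-valued measure every strict interval contains
-- a cover at each end; the statements are double negations because covers need not be decidable.
module Refinement (S : SubPoset) (Φ : SubPoset.A S → ℕ)
  (≼-refl : ∀ x → SubPoset._≼_ S x x)
  (≼-trans : ∀ {x y z} → SubPoset._≼_ S x y → SubPoset._≼_ S y z → SubPoset._≼_ S x z)
  (Φ-strict : ∀ {x y} → SubPoset.Elem S x → SubPoset.Elem S y → _≺_ S x y → Φ x < Φ y) where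
  open SubPoset S

  private
    gap : ∀ {v w fuel} → Elem v → Elem w → _≺_ S v w → Φ w ∸ Φ v ≤ fuel → 0 < fuel
    gap ev ew v≺w bound = ℕ.<-≤-trans (ℕ.m<n⇒0<n∸m (Φ-strict ev ew v≺w)) bound

    above : ∀ fuel v w → Φ w ∸ Φ v ≤ fuel → Elem v → Elem w → _≺_ S v w →
            ¬ (∀ d → Covers S v d → ¬ d ≼ w)
    above zero v w bound ev ew v≺w _ = ℕ.<-irrefl refl (gap ev ew v≺w bound)
    above (suc fuel) v w bound ev ew v≺w none = none w (ev , ew , v≺w , between) (≼-refl w)
      where
      between : ∀ z → Elem z → _≺_ S v z → ¬ (_≺_ S z w)
      between z ez v≺z z≺w = above fuel v z
        (ℕ.≤-pred (ℕ.≤-trans (ℕ.∸-monoˡ-< (Φ-strict ez ew z≺w) (ℕ.<⇒≤ (Φ-strict ev ez v≺z))) bound))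
        ev ez v≺z (λ d v⋖d d≼z → none d v⋖d (≼-trans d≼z (proj₁ z≺w)))

    below : ∀ fuel v w → Φ w ∸ Φ v ≤ fuel → Elem v → Elem w → _≺_ S v w →
            ¬ (∀ d → Covers S d w → ¬ v ≼ d)
    below zero v w bound ev ew v≺w _ = ℕ.<-irrefl refl (gap ev ew v≺w bound)
    below (suc fuel) v w bound ev ew v≺w none = none v (ev , ew , v≺w , between) (≼-refl v)
      where
      between : ∀ z → Elem z → _≺_ S v z → ¬ (_≺_ S z w)
      between z ez v≺z z≺w = below fuel z w
        (ℕ.≤-pred (ℕ.≤-trans (ℕ.∸-monoʳ-< (Φ-strict ev ez v≺z) (ℕ.<⇒≤ (Φ-strict ez ew z≺w))) bound))
        ez ew z≺w (λ d d⋖w z≼d → none d d⋖w (≼-trans (proj₁ v≺z) z≼d))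

  ¬¬cover-above : ∀ v w → Elem v → Elem w → _≺_ S v w → ¬ (∀ d → Covers S v d → ¬ d ≼ w)
  ¬¬cover-above v w = above _ v w ℕ.≤-refl

  ¬¬cover-below : ∀ v w → Elem v → Elem w → _≺_ S v w → ¬ (∀ d → Covers S d w → ¬ v ≼ d)
  ¬¬cover-below v w = below _ v w ℕ.≤-refl

module FinitePoset (P : FinBoundedPoset) where
  open FinBoundedPoset P

  SP : SubPoset
  SP = asSub P

  _≺P_ : Carrier → Carrier → Set
  _≺P_ = _≺_ SP

  _⋖_ : Carrier → Carrier → Set
  _⋖_ = Covers SP

  ∀-dec : {Q : Carrier → Set} → (∀ x → Dec (Q x)) → Dec (∀ x → Q x)
  ∀-dec Q? with all? Q? elems
  ... | yes all = yes (λ x → All.lookup all (complete x))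
  ... | no ¬all = no (λ ∀Q → ¬all (All.tabulate (λ {x} _ → ∀Q x)))

  ∃-dec : {Q : Carrier → Set} → (∀ x → Dec (Q x)) → Dec (∃ Q)
  ∃-dec Q? with any? Q? elems
  ... | yes some = yes (Any.satisfied some)
  ... | no ¬some = no (λ (x , q) → ¬some (Any.map (λ { refl → q }) (complete x)))

  _≺?_ : ∀ x y → Dec (x ≺P y)
  x ≺? y = (x ≤? y) ×-dec ¬? (x ≟ y)

  _⋖?_ : ∀ x y → Dec (x ⋖ y)
  x ⋖? y = yes tt ×-dec yes tt ×-dec (x ≺? y) ×-dec
           ∀-dec (λ z → yes tt →-dec ((x ≺? z) →-dec ¬? (z ≺? y)))

  ≺-irrefl : ∀ {x} → ¬ (x ≺P x)
  ≺-irrefl (_ , x≢x) = x≢x refl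

  ≺⇒≱ : ∀ {x y} → x ≺P y → ¬ (y ≤P x)
  ≺⇒≱ (x≤y , x≢y) y≤x = x≢y (≤-antisym x≤y y≤x)

  ≺-≤-trans : ∀ {x y z} → x ≺P y → y ≤P z → x ≺P z
  ≺-≤-trans (x≤y , x≢y) y≤z = ≤-trans x≤y y≤z , λ { refl → x≢y (≤-antisym x≤y y≤z) }

  ≤-≺-trans : ∀ {x y z} → x ≤P y → y ≺P z → x ≺P z
  ≤-≺-trans x≤y (y≤z , y≢z) = ≤-trans x≤y y≤z , λ { refl → y≢z (≤-antisym y≤z x≤y) }

  ≺-trans : ∀ {x y z} → x ≺P y → y ≺P z → x ≺P z
  ≺-trans x≺y y≺z = ≺-≤-trans x≺y (proj₁ y≺z)

  𝟘≺ : ∀ {p} → p ≢ 𝟘 → 𝟘 ≺P p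
  𝟘≺ p≢𝟘 = 𝟘-least _ , λ 𝟘≡p → p≢𝟘 (sym 𝟘≡p)

  ⋖⇒≺ : ∀ {x y} → x ⋖ y → x ≺P y
  ⋖⇒≺ (_ , _ , x≺y , _) = x≺y

  ⋖-nothing-between : ∀ {x y z} → x ⋖ y → x ≺P z → ¬ (z ≺P y)
  ⋖-nothing-between (_ , _ , _ , between) = between _ tt

  ⋖-upper≢𝟘 : ∀ {p q} → p ⋖ q → q ≢ 𝟘
  ⋖-upper≢𝟘 {p} p⋖q refl = ≺⇒≱ (⋖⇒≺ p⋖q) (𝟘-least p)

  private
    count : {Q : Carrier → Set} → (∀ z → Dec (Q z)) → List Carrier → ℕ
    count Q? [] = 0
    count Q? (x ∷ xs) with Q? x
    ... | yes _ = suc (count Q? xs)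
    ... | no _ = count Q? xs

    count-mono : {Q R : Carrier → Set} (Q? : ∀ z → Dec (Q z)) (R? : ∀ z → Dec (R z)) →
                 (∀ z → Q z → R z) → ∀ xs → count Q? xs ≤ count R? xs
    count-mono Q? R? Q⇒R [] = z≤n
    count-mono Q? R? Q⇒R (x ∷ xs) with Q? x | R? x
    ... | yes _ | yes _ = s≤s (count-mono Q? R? Q⇒R xs)
    ... | yes q | no ¬r = ⊥-elim (¬r (Q⇒R x q))
    ... | no _  | yes _ = ℕ.m≤n⇒m≤1+n (count-mono Q? R? Q⇒R xs)
    ... | no _  | no _  = count-mono Q? R? Q⇒R xs

    count-strict : {Q R : Carrier → Set} (Q? : ∀ z → Dec (Q z)) (R? : ∀ z → Dec (R z)) →
                   (∀ z → Q z → R z) → ∀ xs {y} → y ∈ xs → R y → ¬ Q y → count Q? xs < count R? xs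
    count-strict Q? R? Q⇒R (x ∷ xs) (here refl) r ¬q with Q? x | R? x
    ... | yes q | _     = ⊥-elim (¬q q)
    ... | no _  | yes _ = s≤s (count-mono Q? R? Q⇒R xs)
    ... | no _  | no ¬r = ⊥-elim (¬r r)
    count-strict Q? R? Q⇒R (x ∷ xs) (there y∈) r ¬q with Q? x | R? x
    ... | yes _ | yes _ = s≤s (count-strict Q? R? Q⇒R xs y∈ r ¬q)
    ... | yes q | no ¬r = ⊥-elim (¬r (Q⇒R x q))
    ... | no _  | yes _ = ℕ.m≤n⇒m≤1+n (count-strict Q? R? Q⇒R xs y∈ r ¬q)
    ... | no _  | no _  = count-strict Q? R? Q⇒R xs y∈ r ¬q

  height : Carrier → ℕ
  height x = count (_≤? x) elems

  height-strict : ∀ {x y} → x ≺P y → height x < height y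
  height-strict (x≤y , x≢y) = count-strict (_≤? _) (_≤? _) (λ z z≤x → ≤-trans z≤x x≤y) elems
    (complete _) (≤-refl _) (λ y≤x → x≢y (≤-antisym x≤y y≤x))

  open Refinement SP height ≤-refl ≤-trans (λ _ _ → height-strict)

  cover-above : ∀ {x y} → x ≺P y → ∃[ c ] (x ⋖ c × c ≤P y)
  cover-above {x} {y} x≺y with ∃-dec (λ c → (x ⋖? c) ×-dec (c ≤? y))
  ... | yes found = found
  ... | no none = ⊥-elim (¬¬cover-above x y tt tt x≺y (λ d x⋖d d≤y → none (d , x⋖d , d≤y)))

  cover-below : ∀ {x y} → x ≺P y → ∃[ c ] (x ≤P c × c ⋖ y)
  cover-below {x} {y} x≺y with ∃-dec (λ c → (x ≤? c) ×-dec (c ⋖? y))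
  ... | yes found = found
  ... | no none = ⊥-elim (¬¬cover-below x y tt tt x≺y (λ d d⋖y x≤d → none (d , x≤d , d⋖y)))

  saturate : ∀ {x y} → x ≺P y → ∃[ j ] SatChain SP x y (suc j)
  saturate = go _ ℕ.≤-refl
    where
    go : ∀ fuel {x y} → height y ∸ height x ≤ fuel → x ≺P y → ∃[ j ] SatChain SP x y (suc j)
    go zero bound x≺y = ⊥-elim (ℕ.<-irrefl refl (ℕ.<-≤-trans (ℕ.m<n⇒0<n∸m (height-strict x≺y)) bound))
    go (suc fuel) {x} {y} bound x≺y with cover-above x≺y
    ... | c , x⋖c , c≤y with c ≟ y
    ... | yes refl = 0 , step x⋖c (done tt)
    ... | no c≢y = let j , chain = go fuel bound′ (c≤y , c≢y) in suc j , step x⋖c chain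
      where bound′ : height y ∸ height c ≤ fuel
            bound′ = ℕ.≤-pred (ℕ.≤-trans (ℕ.∸-monoʳ-< (height-strict (⋖⇒≺ x⋖c)) (ℕ.<⇒≤ (height-strict (c≤y , c≢y)))) bound)

  data StrictChain : Carrier → Carrier → ℕ → Set where
    []  : ∀ {x} → StrictChain x x 0
    _∷_ : ∀ {x y z r} → x ≺P y → StrictChain y z r → StrictChain x z (suc r)

  saturate-strictChain : ∀ {x y r} → StrictChain x y r → ∃[ j ] (SatChain SP x y j × r ≤ j)
  saturate-strictChain [] = 0 , done tt , z≤n
  saturate-strictChain (x≺y ∷ rest) with saturate x≺y | saturate-strictChain rest
  ... | j , chain | j′ , chain′ , r≤j′ = suc j + j′ , chain ++ˢ chain′ , s≤s (ℕ.≤-trans r≤j′ (ℕ.m≤n+m j′ j))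

  least𝟘 : Least SP 𝟘
  least𝟘 = tt , λ x _ → 𝟘-least x

  greatest𝟙 : Greatest SP 𝟙
  greatest𝟙 = tt , λ x _ → 𝟙-greatest x

  least⇒≡𝟘 : ∀ {b} → Least SP b → b ≡ 𝟘
  least⇒≡𝟘 (_ , b≤) = ≤-antisym (b≤ 𝟘 tt) (𝟘-least _)

  greatest⇒≡𝟙 : ∀ {t} → Greatest SP t → t ≡ 𝟙
  greatest⇒≡𝟙 (_ , ≤t) = ≤-antisym (𝟙-greatest _) (≤t 𝟙 tt)

  strictChain-length≤ : ∀ {k r} → HasLength SP k → StrictChain 𝟘 𝟙 r → r ≤ k
  strictChain-length≤ (_ , bound) chain with saturate-strictChain chain
  ... | j , sat , r≤j = ℕ.≤-trans r≤j (bound 𝟘 𝟙 j least𝟘 greatest𝟙 sat)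

  crossing : ∀ {x y j q} → SatChain SP x y j → ¬ q ≤P x → q ≤P y →
             ∃[ t ] ∃[ t′ ] (x ≤P t × ¬ q ≤P t × t ⋖ t′ × q ≤P t′)
  crossing (done _) q≰x q≤y = ⊥-elim (q≰x q≤y)
  crossing {x} {q = q} (step {y = c} x⋖c chain) q≰x q≤y with q ≤? c
  ... | yes q≤c = x , c , ≤-refl x , q≰x , x⋖c , q≤c
  ... | no q≰c =
    let t , t′ , c≤t , rest = crossing chain q≰c q≤y in t , t′ , ≤-trans (proj₁ (⋖⇒≺ x⋖c)) c≤t , rest

  crossing-below𝟙 : ∀ {x q} → ¬ q ≤P x → ∃[ t ] ∃[ t′ ] (x ≤P t × ¬ q ≤P t × t ⋖ t′ × q ≤P t′)
  crossing-below𝟙 {x} {q} q≰x =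
    crossing (proj₂ (saturate (𝟙-greatest x , λ { refl → q≰x (𝟙-greatest q) }))) q≰x (𝟙-greatest q)

  𝟘-minimal : Minimal SP 𝟘
  𝟘-minimal = tt , λ y _ y≺𝟘 → ≺⇒≱ y≺𝟘 (𝟘-least y)

  joinIrr⇒≢𝟘 : ∀ {j} → JoinIrr SP j → j ≢ 𝟘
  joinIrr⇒≢𝟘 (_ , ¬minimal , _) refl = ¬minimal 𝟘-minimal

  meetIrr-cover-unique : ∀ {x c c′} → MeetIrr SP x → x ⋖ c → x ⋖ c′ → c ≡ c′
  meetIrr-cover-unique (_ , _ , (_ , _ , only)) x⋖c x⋖c′ = trans (only _ x⋖c) (sym (only _ x⋖c′))

  joinIrr-cover-unique : ∀ {x c c′} → JoinIrr SP x → c ⋖ x → c′ ⋖ x → c ≡ c′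
  joinIrr-cover-unique (_ , _ , (_ , _ , only)) c⋖x c′⋖x = trans (only _ c⋖x) (sym (only _ c′⋖x))

  -- The junk value x when x has no upper cover.
  upperCover : Carrier → Carrier
  upperCover x with ∃-dec (x ⋖?_)
  ... | yes (y , _) = y
  ... | no _ = x

  upperCover-⋖ : ∀ {x} → MeetIrr SP x → x ⋖ upperCover x
  upperCover-⋖ {x} (_ , _ , (y , x⋖y , _)) with ∃-dec (x ⋖?_)
  ... | yes (_ , x⋖y′) = x⋖y′
  ... | no none = ⊥-elim (none (y , x⋖y))

vec-ext : ∀ {A : Set} {n} (v w : Vec A n) → (∀ i → lookup v i ≡ lookup w i) → v ≡ w
vec-ext v w eq = trans (sym (tabulate∘lookup v)) (trans (tabulate-cong eq) (tabulate∘lookup w))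

sum-mono : ∀ {r} (f g : Fin r → ℕ) → (∀ i → f i ≤ g i) → sum f ≤ sum g
sum-mono {zero} f g f≤g = z≤n
sum-mono {suc r} f g f≤g = ℕ.+-mono-≤ (f≤g Fin.zero) (sum-mono _ _ (λ i → f≤g (Fin.suc i)))

sum-strict : ∀ {r} (f g : Fin r → ℕ) → (∀ i → f i ≤ g i) → ∀ i → f i < g i → sum f < sum g
sum-strict f g f≤g Fin.zero f<g = ℕ.+-mono-<-≤ f<g (sum-mono _ _ (λ i → f≤g (Fin.suc i)))
sum-strict f g f≤g (Fin.suc i) f<g = ℕ.+-mono-≤-< (f≤g Fin.zero) (sum-strict _ _ (λ j → f≤g (Fin.suc j)) i f<g)

sum-positive : ∀ {r} (f : Fin r → ℕ) i → 0 < f i → 0 < sum f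
sum-positive f Fin.zero 0<f = ℕ.<-≤-trans 0<f (ℕ.m≤m+n _ _)
sum-positive f (Fin.suc i) 0<f = ℕ.<-≤-trans (sum-positive (λ j → f (Fin.suc j)) i 0<f) (ℕ.m≤n+m _ _)

sum-const : ∀ r k → sum {r} (λ _ → k) ≡ r * k
sum-const zero k = refl
sum-const (suc r) k = cong (k +_) (sum-const r k)

upward-closed-threshold : ∀ r (D : Fin r → Set) → (∀ i → Dec (D i)) → (∀ i j → D i → toℕ i ≤ toℕ j → D j) →
                          ∃[ a ] (∀ i → (D i → a ≤ toℕ i) × (a ≤ toℕ i → D i))
upward-closed-threshold zero D D? up = 0 , λ ()
upward-closed-threshold (suc r) D D? up with D? Fin.zero
... | yes D₀ = 0 , λ i → (λ _ → z≤n) , (λ _ → up Fin.zero i D₀ z≤n)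
... | no ¬D₀ with upward-closed-threshold r (λ i → D (Fin.suc i)) (λ i → D? (Fin.suc i))
                    (λ i j Dᵢ i≤j → up (Fin.suc i) (Fin.suc j) Dᵢ (s≤s i≤j))
... | a , threshold = suc a , shifted
  where
  shifted : ∀ i → (D i → suc a ≤ toℕ i) × (suc a ≤ toℕ i → D i)
  shifted Fin.zero = (λ D₀ → ⊥-elim (¬D₀ D₀)) , (λ ())
  shifted (Fin.suc i) = (λ Dᵢ → s≤s (proj₁ (threshold i) Dᵢ)) , (λ { (s≤s a≤i) → proj₂ (threshold i) a≤i })

module MCoverPoset (P : FinBoundedPoset) (n : ℕ) where
  open FinBoundedPoset P
  open FinitePoset P

  m : ℕ
  m = suc n

  V : Set
  V = Vec Carrier m

  Q : SubPoset
  Q = MCover P m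

  infixl 30 _!_
  _!_ : V → Fin m → Carrier
  _!_ = lookup

  InQ : V → Set
  InQ = SubPoset.Elem Q

  _⊑_ : V → V → Set
  _⊑_ = SubPoset._≼_ Q

  _⊏_ : V → V → Set
  _⊏_ = _≺_ Q

  _⋖Q_ : V → V → Set
  _⋖Q_ = Covers Q

  _≟V_ : (u v : V) → Dec (u ≡ v)
  _≟V_ = Vec.≡-dec _≟_

  ⊑-refl : ∀ v → v ⊑ v
  ⊑-refl v i = ≤-refl _

  ⊑-trans : ∀ {u v w} → u ⊑ v → v ⊑ w → u ⊑ w
  ⊑-trans u⊑v v⊑w i = ≤-trans (u⊑v i) (v⊑w i)

  differing-coordinate : ∀ (u v : V) → u ≢ v → ∃[ i ] (u ! i ≢ v ! i)
  differing-coordinate u v u≢v with Fin.all? (λ i → u ! i ≟ v ! i)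
  ... | yes same = ⊥-elim (u≢v (vec-ext u v same))
  ... | no ¬same = Fin.¬∀⟶∃¬ m _ (λ i → u ! i ≟ v ! i) ¬same

  weight : V → ℕ
  weight v = sum (λ i → height (v ! i))

  weight-strict : ∀ {u v} → u ⊏ v → weight u < weight v
  weight-strict {u} {v} (u⊑v , u≢v) with differing-coordinate u v u≢v
  ... | i , uᵢ≢vᵢ = sum-strict _ _ height-mono i (height-strict (u⊑v i , uᵢ≢vᵢ))
    where
    height-mono : ∀ j → height (u ! j) ≤ height (v ! j)
    height-mono j with u ! j ≟ v ! j
    ... | yes uⱼ≡vⱼ = ℕ.≤-reflexive (cong height uⱼ≡vⱼ)
    ... | no uⱼ≢vⱼ = ℕ.<⇒≤ (height-strict (u⊑v j , uⱼ≢vⱼ))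

  open Refinement Q weight ⊑-refl (λ {u} {v} {w} → ⊑-trans {u} {v} {w}) (λ _ _ → weight-strict)
    renaming (¬¬cover-above to ¬¬coverQ-above) public

  OneOf : Carrier → Carrier → Carrier → Set
  OneOf p q c = c ≡ 𝟘 ⊎ c ≡ p ⊎ c ≡ q

  OneOf-≤ : ∀ {p q c} → p ⋖ q → OneOf p q c → c ≤P q
  OneOf-≤ p⋖q (inj₁ refl) = 𝟘-least _
  OneOf-≤ p⋖q (inj₂ (inj₁ refl)) = proj₁ (⋖⇒≺ p⋖q)
  OneOf-≤ p⋖q (inj₂ (inj₂ refl)) = ≤-refl _

  coverCond-one : ∀ {v} p → (∀ i → v ! i ≡ 𝟘 ⊎ v ! i ≡ p) → CoverCond P m v
  coverCond-one {v} p values with p ≟ 𝟘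
  ... | yes refl = inj₁ (λ { x (x≢𝟘 , i , refl) → x≢𝟘 (zero-of (values i)) })
    where zero-of : ∀ {c} → c ≡ 𝟘 ⊎ c ≡ 𝟘 → c ≡ 𝟘
          zero-of (inj₁ e) = e
          zero-of (inj₂ e) = e
  ... | no p≢𝟘 with Fin.any? (λ i → v ! i ≟ p)
  ... | yes (i , vᵢ≡p) = inj₂ (inj₁ (p , (p≢𝟘 , i , vᵢ≡p) , λ { x (x≢𝟘 , j , refl) → is-p (values j) x≢𝟘 }))
    where is-p : ∀ {c} → c ≡ 𝟘 ⊎ c ≡ p → c ≢ 𝟘 → c ≡ p
          is-p (inj₁ c≡𝟘) c≢𝟘 = ⊥-elim (c≢𝟘 c≡𝟘)
          is-p (inj₂ c≡p) _ = c≡p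
  ... | no no-p = inj₁ (λ { x (x≢𝟘 , j , refl) → absent (values j) x≢𝟘 (λ e → no-p (j , e)) })
    where absent : ∀ {c} → c ≡ 𝟘 ⊎ c ≡ p → c ≢ 𝟘 → c ≢ p → ⊥
          absent (inj₁ c≡𝟘) c≢𝟘 _ = c≢𝟘 c≡𝟘
          absent (inj₂ c≡p) _ c≢p = c≢p c≡p

  coverCond-two : ∀ {v p q} → p ⋖ q → (∀ i → OneOf p q (v ! i)) → CoverCond P m v
  coverCond-two {v} {p} {q} p⋖q values with p ≟ 𝟘
  ... | yes refl = coverCond-one {v} q (λ i → merge (values i))
    where merge : ∀ {c} → OneOf 𝟘 q c → c ≡ 𝟘 ⊎ c ≡ q
          merge (inj₁ e) = inj₁ e
          merge (inj₂ (inj₁ e)) = inj₁ e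
          merge (inj₂ (inj₂ e)) = inj₂ e
  ... | no p≢𝟘 with Fin.any? (λ i → v ! i ≟ p) | Fin.any? (λ i → v ! i ≟ q)
  ... | yes (i , vᵢ≡p) | yes (j , vⱼ≡q) =
    inj₂ (inj₂ (p , q , p⋖q , (p≢𝟘 , i , vᵢ≡p) , (⋖-upper≢𝟘 p⋖q , j , vⱼ≡q) , λ { x (x≢𝟘 , l , refl) → nonzero (values l) x≢𝟘 }))
    where nonzero : ∀ {c} → OneOf p q c → c ≢ 𝟘 → c ≡ p ⊎ c ≡ q
          nonzero (inj₁ c≡𝟘) c≢𝟘 = ⊥-elim (c≢𝟘 c≡𝟘)
          nonzero (inj₂ c≡p∨q) _ = c≡p∨q
  ... | yes _ | no no-q = coverCond-one {v} p (λ i → drop-q (values i) (λ e → no-q (i , e)))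
    where drop-q : ∀ {c} → OneOf p q c → c ≢ q → c ≡ 𝟘 ⊎ c ≡ p
          drop-q (inj₁ e) _ = inj₁ e
          drop-q (inj₂ (inj₁ e)) _ = inj₂ e
          drop-q (inj₂ (inj₂ e)) c≢q = ⊥-elim (c≢q e)
  ... | no no-p | _ = coverCond-one {v} q (λ i → drop-p (values i) (λ e → no-p (i , e)))
    where drop-p : ∀ {c} → OneOf p q c → c ≢ p → c ≡ 𝟘 ⊎ c ≡ q
          drop-p (inj₁ e) _ = inj₁ e
          drop-p (inj₂ (inj₁ e)) c≢p = ⊥-elim (c≢p e)
          drop-p (inj₂ (inj₂ e)) _ = inj₂ e

  data CoverCondView (v : V) : Set where
    allZero   : (∀ i → v ! i ≡ 𝟘) → CoverCondView v
    oneValue  : ∀ p → p ≢ 𝟘 → (∃[ i ] (v ! i ≡ p)) → (∀ i → v ! i ≡ 𝟘 ⊎ v ! i ≡ p) → CoverCondView v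
    twoValues : ∀ p q → p ⋖ q → p ≢ 𝟘 → (∃[ i ] (v ! i ≡ p)) → (∃[ i ] (v ! i ≡ q)) →
                (∀ i → OneOf p q (v ! i)) → CoverCondView v

  coverCond-view : ∀ {v} → CoverCond P m v → CoverCondView v
  coverCond-view {v} (inj₁ none) = allZero all-𝟘
    where all-𝟘 : ∀ i → v ! i ≡ 𝟘
          all-𝟘 i with v ! i ≟ 𝟘
          ... | yes e = e
          ... | no vᵢ≢𝟘 = ⊥-elim (none (v ! i) (vᵢ≢𝟘 , i , refl))
  coverCond-view {v} (inj₂ (inj₁ (p , (p≢𝟘 , p∈v) , only))) = oneValue p p≢𝟘 p∈v values
    where values : ∀ i → v ! i ≡ 𝟘 ⊎ v ! i ≡ p
          values i with v ! i ≟ 𝟘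
          ... | yes e = inj₁ e
          ... | no vᵢ≢𝟘 = inj₂ (only (v ! i) (vᵢ≢𝟘 , i , refl))
  coverCond-view {v} (inj₂ (inj₂ (p , q , p⋖q , (p≢𝟘 , p∈v) , (_ , q∈v) , only))) = twoValues p q p⋖q p≢𝟘 p∈v q∈v values
    where values : ∀ i → OneOf p q (v ! i)
          values i with v ! i ≟ 𝟘
          ... | yes e = inj₁ e
          ... | no vᵢ≢𝟘 = inj₂ (only (v ! i) (vᵢ≢𝟘 , i , refl))

  distinct-nonzero⇒⋖ : ∀ {z} → InQ z → ∀ i j → z ! i ≢ 𝟘 → z ! j ≢ 𝟘 → z ! i ≢ z ! j →
                       z ! i ⋖ z ! j ⊎ z ! j ⋖ z ! i
  distinct-nonzero⇒⋖ {z} (_ , cc) i j zᵢ≢𝟘 zⱼ≢𝟘 zᵢ≢zⱼ with coverCond-view {z} cc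
  ... | allZero all-𝟘 = ⊥-elim (zᵢ≢𝟘 (all-𝟘 i))
  ... | oneValue p _ _ values = ⊥-elim (zᵢ≢zⱼ (trans (is-p (values i) zᵢ≢𝟘) (sym (is-p (values j) zⱼ≢𝟘))))
    where is-p : ∀ {c} → c ≡ 𝟘 ⊎ c ≡ p → c ≢ 𝟘 → c ≡ p
          is-p (inj₁ e) c≢𝟘 = ⊥-elim (c≢𝟘 e)
          is-p (inj₂ e) _ = e
  ... | twoValues p q p⋖q _ _ _ values = cases (values i) (values j) zᵢ≢𝟘 zⱼ≢𝟘 zᵢ≢zⱼ
    where cases : ∀ {a b} → OneOf p q a → OneOf p q b → a ≢ 𝟘 → b ≢ 𝟘 → a ≢ b → a ⋖ b ⊎ b ⋖ a
          cases (inj₁ e) _ a≢𝟘 _ _ = ⊥-elim (a≢𝟘 e)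
          cases _ (inj₁ e) _ b≢𝟘 _ = ⊥-elim (b≢𝟘 e)
          cases (inj₂ (inj₁ refl)) (inj₂ (inj₁ refl)) _ _ a≢b = ⊥-elim (a≢b refl)
          cases (inj₂ (inj₁ refl)) (inj₂ (inj₂ refl)) _ _ _ = inj₁ p⋖q
          cases (inj₂ (inj₂ refl)) (inj₂ (inj₁ refl)) _ _ _ = inj₂ p⋖q
          cases (inj₂ (inj₂ refl)) (inj₂ (inj₂ refl)) _ _ a≢b = ⊥-elim (a≢b refl)

  ¬three-distinct-nonzero : ∀ {z} → InQ z → ∀ i j l → z ! i ≢ 𝟘 → z ! j ≢ 𝟘 → z ! l ≢ 𝟘 →
                            z ! i ≢ z ! j → z ! i ≢ z ! l → ¬ (z ! j ≢ z ! l)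
  ¬three-distinct-nonzero {z} (_ , cc) i j l zᵢ≢𝟘 zⱼ≢𝟘 zₗ≢𝟘 dᵢⱼ dᵢₗ dⱼₗ with coverCond-view {z} cc
  ... | allZero all-𝟘 = zᵢ≢𝟘 (all-𝟘 i)
  ... | oneValue p _ _ values = dᵢⱼ (trans (is-p (values i) zᵢ≢𝟘) (sym (is-p (values j) zⱼ≢𝟘)))
    where is-p : ∀ {c} → c ≡ 𝟘 ⊎ c ≡ p → c ≢ 𝟘 → c ≡ p
          is-p (inj₁ e) c≢𝟘 = ⊥-elim (c≢𝟘 e)
          is-p (inj₂ e) _ = e
  ... | twoValues p q _ _ _ _ values = pigeonhole (values i) (values j) (values l) zᵢ≢𝟘 zⱼ≢𝟘 zₗ≢𝟘 dᵢⱼ dᵢₗ dⱼₗ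
    where pigeonhole : ∀ {a b c} → OneOf p q a → OneOf p q b → OneOf p q c → a ≢ 𝟘 → b ≢ 𝟘 → c ≢ 𝟘 →
                       a ≢ b → a ≢ c → b ≢ c → ⊥
          pigeonhole (inj₁ e) _ _ a≢𝟘 _ _ _ _ _ = a≢𝟘 e
          pigeonhole _ (inj₁ e) _ _ b≢𝟘 _ _ _ _ = b≢𝟘 e
          pigeonhole _ _ (inj₁ e) _ _ c≢𝟘 _ _ _ = c≢𝟘 e
          pigeonhole (inj₂ (inj₁ refl)) (inj₂ (inj₁ refl)) _ _ _ _ a≢b _ _ = a≢b refl
          pigeonhole (inj₂ (inj₁ refl)) (inj₂ (inj₂ refl)) (inj₂ (inj₁ refl)) _ _ _ _ a≢c _ = a≢c refl
          pigeonhole (inj₂ (inj₁ refl)) (inj₂ (inj₂ refl)) (inj₂ (inj₂ refl)) _ _ _ _ _ b≢c = b≢c refl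
          pigeonhole (inj₂ (inj₂ refl)) (inj₂ (inj₁ refl)) (inj₂ (inj₁ refl)) _ _ _ _ _ b≢c = b≢c refl
          pigeonhole (inj₂ (inj₂ refl)) (inj₂ (inj₁ refl)) (inj₂ (inj₂ refl)) _ _ _ _ a≢c _ = a≢c refl
          pigeonhole (inj₂ (inj₂ refl)) (inj₂ (inj₂ refl)) _ _ _ _ a≢b _ _ = a≢b refl

  private
    choose : {A : Set} → Dec A → Carrier → Carrier → Carrier
    choose (yes _) x _ = x
    choose (no _) _ y = y

  blocks : ℕ → Carrier → Carrier → V
  blocks a x y = tabulate (λ i → choose (toℕ i ℕ.<? a) x y)

  blocks-view : ∀ a x y i → (toℕ i < a × blocks a x y ! i ≡ x) ⊎ (a ≤ toℕ i × blocks a x y ! i ≡ y)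
  blocks-view a x y i rewrite lookup∘tabulate (λ i → choose (toℕ i ℕ.<? a) x y) i
    with toℕ i ℕ.<? a
  ... | yes i<a = inj₁ (i<a , refl)
  ... | no i≮a = inj₂ (ℕ.≮⇒≥ i≮a , refl)

  blocks-< : ∀ {a x y} i → toℕ i < a → blocks a x y ! i ≡ x
  blocks-< {a} {x} {y} i i<a with blocks-view a x y i
  ... | inj₁ (_ , e) = e
  ... | inj₂ (a≤i , _) = ⊥-elim (ℕ.<⇒≱ i<a a≤i)

  blocks-≥ : ∀ {a x y} i → a ≤ toℕ i → blocks a x y ! i ≡ y
  blocks-≥ {a} {x} {y} i a≤i with blocks-view a x y i
  ... | inj₁ (i<a , _) = ⊥-elim (ℕ.<⇒≱ i<a a≤i)
  ... | inj₂ (_ , e) = e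

  blocks-values : ∀ {a x y} i → blocks a x y ! i ≡ x ⊎ blocks a x y ! i ≡ y
  blocks-values {a} {x} {y} i with blocks-view a x y i
  ... | inj₁ (_ , e) = inj₁ e
  ... | inj₂ (_ , e) = inj₂ e

  constant : Carrier → V
  constant x = blocks 0 x x

  constant-lookup : ∀ x i → constant x ! i ≡ x
  constant-lookup x i = blocks-≥ {0} {x} {x} i z≤n

  blocks-multichain : ∀ {a x y} → x ≤P y → Multichain P m (blocks a x y)
  blocks-multichain {a} {x} {y} x≤y i j i≤j with blocks-view a x y i | blocks-view a x y j
  ... | inj₁ (_ , eᵢ) | inj₁ (_ , eⱼ) = subst₂ _≤P_ (sym eᵢ) (sym eⱼ) (≤-refl x)
  ... | inj₁ (_ , eᵢ) | inj₂ (_ , eⱼ) = subst₂ _≤P_ (sym eᵢ) (sym eⱼ) x≤y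
  ... | inj₂ (a≤i , _) | inj₁ (j<a , _) = ⊥-elim (ℕ.<⇒≱ j<a (ℕ.≤-trans a≤i i≤j))
  ... | inj₂ (_ , eᵢ) | inj₂ (_ , eⱼ) = subst₂ _≤P_ (sym eᵢ) (sym eⱼ) (≤-refl y)

  blocks-inQ : ∀ {a x y} → x ⋖ y → InQ (blocks a x y)
  blocks-inQ {a} {x} {y} x⋖y = blocks-multichain (proj₁ (⋖⇒≺ x⋖y)) , coverCond-two {blocks a x y} x⋖y values
    where values : ∀ i → OneOf x y (blocks a x y ! i)
          values i with blocks-view a x y i
          ... | inj₁ (_ , e) = inj₂ (inj₁ e)
          ... | inj₂ (_ , e) = inj₂ (inj₂ e)

  blocks𝟘-inQ : ∀ {a} p → InQ (blocks a 𝟘 p)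
  blocks𝟘-inQ {a} p = blocks-multichain (𝟘-least p) , coverCond-one {blocks a 𝟘 p} p values
    where values : ∀ i → blocks a 𝟘 p ! i ≡ 𝟘 ⊎ blocks a 𝟘 p ! i ≡ p
          values i with blocks-view a 𝟘 p i
          ... | inj₁ (_ , e) = inj₁ e
          ... | inj₂ (_ , e) = inj₂ e

  constant-inQ : ∀ x → InQ (constant x)
  constant-inQ x = blocks-multichain {0} (≤-refl x) , coverCond-one {constant x} x (λ i → inj₂ (constant-lookup x i))

  update-here : ∀ (v : V) i c → (v [ i ]≔ c) ! i ≡ c
  update-here v i c = lookup∘update i v c

  update-elsewhere : ∀ (v : V) i c j → j ≢ i → (v [ i ]≔ c) ! j ≡ v ! j
  update-elsewhere v i c j j≢i = lookup∘update′ j≢i v c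

  update-multichain : ∀ {v} i c → Multichain P m v → (∀ j → toℕ j < toℕ i → v ! j ≤P c) →
                      (∀ j → toℕ i < toℕ j → c ≤P v ! j) → Multichain P m (v [ i ]≔ c)
  update-multichain {v} i c chain below above j l j≤l with j Fin.≟ i | l Fin.≟ i
  ... | yes refl | yes refl = subst₂ _≤P_ (sym (update-here v i c)) (sym (update-here v i c)) (≤-refl c)
  ... | yes refl | no l≢i = subst₂ _≤P_ (sym (update-here v i c)) (sym (update-elsewhere v i c l l≢i))
        (above l (ℕ.≤∧≢⇒< j≤l (λ e → l≢i (Fin.toℕ-injective (sym e)))))
  ... | no j≢i | yes refl = subst₂ _≤P_ (sym (update-elsewhere v i c j j≢i)) (sym (update-here v i c))
        (below j (ℕ.≤∧≢⇒< j≤l (λ e → j≢i (Fin.toℕ-injective e))))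
  ... | no j≢i | no l≢i = subst₂ _≤P_ (sym (update-elsewhere v i c j j≢i)) (sym (update-elsewhere v i c l l≢i)) (chain j l j≤l)

  update-inQ : ∀ {v p q} i c → p ⋖ q → Multichain P m v →
               (∀ j → toℕ j < toℕ i → v ! j ≤P c) → (∀ j → toℕ i < toℕ j → c ≤P v ! j) →
               OneOf p q c → (∀ j → j ≢ i → OneOf p q (v ! j)) → InQ (v [ i ]≔ c)
  update-inQ {v} {p} {q} i c p⋖q chain below above c-value others =
    update-multichain {v} i c chain below above , coverCond-two {v [ i ]≔ c} p⋖q values
    where values : ∀ j → OneOf p q ((v [ i ]≔ c) ! j)
          values j with j Fin.≟ i
          ... | yes refl = subst (OneOf p q) (sym (update-here v i c)) c-value
          ... | no j≢i = subst (OneOf p q) (sym (update-elsewhere v i c j j≢i)) (others j j≢i)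

  single-coordinate-cover : ∀ {v w} i → InQ v → InQ w → (∀ j → j ≢ i → v ! j ≡ w ! j) → v ! i ≺P w ! i →
    (∀ z → InQ z → (∀ j → j ≢ i → z ! j ≡ v ! j) → v ! i ≺P z ! i → ¬ (z ! i ≺P w ! i)) → v ⋖Q w
  single-coordinate-cover {v} {w} i v∈Q w∈Q same vᵢ≺wᵢ nothing-between =
    v∈Q , w∈Q , (v⊑w , λ v≡w → proj₂ vᵢ≺wᵢ (cong (_! i) v≡w)) , between
    where
    v⊑w : v ⊑ w
    v⊑w j with j Fin.≟ i
    ... | yes refl = proj₁ vᵢ≺wᵢ
    ... | no j≢i = subst (v ! j ≤P_) (same j j≢i) (≤-refl _)
    between : ∀ z → InQ z → v ⊏ z → ¬ (z ⊏ w)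
    between z z∈Q (v⊑z , v≢z) (z⊑w , z≢w) with z ! i ≟ v ! i | z ! i ≟ w ! i
    ... | yes zᵢ≡vᵢ | _ = v≢z (vec-ext v z agree)
      where agree : ∀ j → v ! j ≡ z ! j
            agree j with j Fin.≟ i
            ... | yes refl = sym zᵢ≡vᵢ
            ... | no j≢i = ≤-antisym (v⊑z j) (subst (z ! j ≤P_) (sym (same j j≢i)) (z⊑w j))
    ... | no _ | yes zᵢ≡wᵢ = z≢w (vec-ext z w agree)
      where agree : ∀ j → z ! j ≡ w ! j
            agree j with j Fin.≟ i
            ... | yes refl = zᵢ≡wᵢ
            ... | no j≢i = ≤-antisym (z⊑w j) (subst (_≤P z ! j) (same j j≢i) (v⊑z j))
    ... | no zᵢ≢vᵢ | no zᵢ≢wᵢ = nothing-between z z∈Q z-same (v⊑z i , λ e → zᵢ≢vᵢ (sym e)) (z⊑w i , zᵢ≢wᵢ)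
      where z-same : ∀ j → j ≢ i → z ! j ≡ v ! j
            z-same j j≢i = ≤-antisym (subst (z ! j ≤P_) (sym (same j j≢i)) (z⊑w j)) (v⊑z j)

  single-coordinate-⋖ : ∀ {v w} i → InQ v → InQ w → (∀ j → j ≢ i → v ! j ≡ w ! j) → v ! i ⋖ w ! i → v ⋖Q w
  single-coordinate-⋖ i v∈Q w∈Q same vᵢ⋖wᵢ =
    single-coordinate-cover i v∈Q w∈Q same (⋖⇒≺ vᵢ⋖wᵢ) (λ z _ _ → ⋖-nothing-between vᵢ⋖wᵢ)

  blocks-chain : ∀ {x y} → x ⋖ y → ∀ s → s ≤ m → SatChain Q (blocks s x y) (blocks 0 x y) s
  blocks-chain x⋖y zero _ = done (blocks-inQ {0} x⋖y)
  blocks-chain {x} {y} x⋖y (suc s) s<m = step raise (blocks-chain x⋖y s (ℕ.<⇒≤ s<m))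
    where
    i : Fin m
    i = fromℕ< s<m
    i≡s : toℕ i ≡ s
    i≡s = Fin.toℕ-fromℕ< s<m
    same : ∀ j → j ≢ i → blocks (suc s) x y ! j ≡ blocks s x y ! j
    same j j≢i with blocks-view (suc s) x y j | blocks-view s x y j
    ... | inj₁ (_ , e₁) | inj₁ (_ , e₂) = trans e₁ (sym e₂)
    ... | inj₂ (_ , e₁) | inj₂ (_ , e₂) = trans e₁ (sym e₂)
    ... | inj₁ (j<1+s , _) | inj₂ (s≤j , _) =
      ⊥-elim (j≢i (Fin.toℕ-injective (trans (ℕ.≤-antisym (ℕ.≤-pred j<1+s) s≤j) (sym i≡s))))
    ... | inj₂ (1+s≤j , _) | inj₁ (j<s , _) = ⊥-elim (ℕ.<⇒≱ j<s (ℕ.≤-trans (ℕ.n≤1+n s) 1+s≤j))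
    raise : blocks (suc s) x y ⋖Q blocks s x y
    raise = single-coordinate-⋖ i (blocks-inQ x⋖y) (blocks-inQ x⋖y) same
      (subst₂ _⋖_ (sym (blocks-< i (subst (_< suc s) (sym i≡s) (ℕ.n<1+n s))))
                  (sym (blocks-≥ i (ℕ.≤-reflexive (sym i≡s)))) x⋖y)

  constant-chain : ∀ {x y j} → SatChain SP x y j → SatChain Q (constant x) (constant y) (m * j)
  constant-chain {x} (done _) = subst (SatChain Q (constant x) (constant x)) (sym (ℕ.*-zeroʳ m)) (done (constant-inQ x))
  constant-chain {x} {z} (step {y = y} {k = j} x⋖y chain) =
    subst (SatChain Q (constant x) (constant z)) (sym (ℕ.*-suc m j)) (one-level ++ˢ constant-chain chain)
    where
    one-level : SatChain Q (constant x) (constant y) m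
    one-level = subst₂ (λ u w → SatChain Q u w m)
      (vec-ext _ _ (λ i → trans (blocks-< {m} {x} {y} i (Fin.toℕ<n i)) (sym (constant-lookup x i))))
      (vec-ext _ _ (λ i → trans (blocks-≥ {0} {x} {y} i z≤n) (sym (constant-lookup y i))))
      (blocks-chain x⋖y m ℕ.≤-refl)

  moved : V → V → Fin m → ℕ
  moved u v i with u ! i ≟ v ! i
  ... | yes _ = 0
  ... | no _ = 1

  -- Each cover of Q moves at least one coordinate, and each coordinate moves along a strict chain.
  project-chain : ∀ {u w j} → SatChain Q u w j →
                  ∃ λ (r : Fin m → ℕ) → (∀ i → StrictChain (u ! i) (w ! i) (r i)) × j ≤ sum r
  project-chain (done _) = (λ _ → 0) , (λ _ → []) , z≤n
  project-chain {u} {w} (step {y = v} {k = j} (_ , _ , (u⊑v , u≢v) , _) chain) with project-chain chain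
  ... | r , chains , j≤∑r = (λ i → moved u v i + r i) , (λ i → extend i (chains i)) ,
        subst (suc j ≤_) (sym (∑-distrib-+ (moved u v) r)) (ℕ.+-mono-≤ some-moved j≤∑r)
    where
    extend : ∀ {r} i → StrictChain (v ! i) (w ! i) r → StrictChain (u ! i) (w ! i) (moved u v i + r)
    extend i chainᵢ with u ! i ≟ v ! i
    ... | yes uᵢ≡vᵢ = subst (λ c → StrictChain c (w ! i) _) (sym uᵢ≡vᵢ) chainᵢ
    ... | no uᵢ≢vᵢ = (u⊑v i , uᵢ≢vᵢ) ∷ chainᵢ
    some-moved : 1 ≤ sum (moved u v)
    some-moved with differing-coordinate u v u≢v
    ... | i , uᵢ≢vᵢ = sum-positive (moved u v) i (moved-positive uᵢ≢vᵢ)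
      where moved-positive : u ! i ≢ v ! i → 0 < moved u v i
            moved-positive uᵢ≢vᵢ with u ! i ≟ v ! i
            ... | yes e = ⊥-elim (uᵢ≢vᵢ e)
            ... | no _ = s≤s z≤n

  constant𝟘-least : Least Q (constant 𝟘)
  constant𝟘-least = constant-inQ 𝟘 , λ v _ i → subst (_≤P v ! i) (sym (constant-lookup 𝟘 i)) (𝟘-least _)

  constant𝟙-greatest : Greatest Q (constant 𝟙)
  constant𝟙-greatest = constant-inQ 𝟙 , λ v _ i → subst (v ! i ≤P_) (sym (constant-lookup 𝟙 i)) (𝟙-greatest _)

  hasLength-mcover : ∀ {k} → HasLength SP k → HasLength Q (m * k)
  hasLength-mcover {k} hasLength@((b , t , b-least , t-greatest , chain) , _) =
    (constant 𝟘 , constant 𝟙 , constant𝟘-least , constant𝟙-greatest ,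
     constant-chain (subst₂ (λ x y → SatChain SP x y k) (least⇒≡𝟘 b-least) (greatest⇒≡𝟙 t-greatest) chain)) ,
    bound
    where
    bound : ∀ b t j → Least Q b → Greatest Q t → SatChain Q b t j → j ≤ m * k
    bound b t j b-least t-greatest chain with project-chain chain
    ... | r , chains , j≤∑r =
      ℕ.≤-trans j≤∑r (ℕ.≤-trans (sum-mono r (λ _ → k) r≤k) (ℕ.≤-reflexive (sum-const m k)))
      where
      b≡𝟘 : ∀ i → b ! i ≡ 𝟘
      b≡𝟘 i = ≤-antisym (subst (b ! i ≤P_) (constant-lookup 𝟘 i) (proj₂ b-least (constant 𝟘) (constant-inQ 𝟘) i)) (𝟘-least _)
      t≡𝟙 : ∀ i → t ! i ≡ 𝟙
      t≡𝟙 i = ≤-antisym (𝟙-greatest _) (subst (_≤P t ! i) (constant-lookup 𝟙 i) (proj₂ t-greatest (constant 𝟙) (constant-inQ 𝟙) i))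
      r≤k : ∀ i → r i ≤ k
      r≤k i = strictChain-length≤ hasLength (subst₂ (λ x y → StrictChain x y (r i)) (b≡𝟘 i) (t≡𝟙 i) (chains i))

  last : Fin m
  last = fromℕ< (ℕ.n<1+n n)

  toℕ-last : toℕ last ≡ n
  toℕ-last = Fin.toℕ-fromℕ< (ℕ.n<1+n n)

  ≤-last : ∀ (i : Fin m) → toℕ i ≤ toℕ last
  ≤-last i = subst (toℕ i ≤_) (sym toℕ-last) (ℕ.≤-pred (Fin.toℕ<n i))

  ⋖Q-lower-maximal : ∀ {z y v} → z ⋖Q v → InQ y → y ⊏ v → z ⊑ y → z ≡ y
  ⋖Q-lower-maximal {z} {y} (_ , _ , _ , between) y∈Q y⊏v z⊑y with z ≟V y
  ... | yes z≡y = z≡y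
  ... | no z≢y = ⊥-elim (between y y∈Q (z⊑y , z≢y) y⊏v)

  ⋖Q-upper-minimal : ∀ {v y z} → v ⋖Q z → InQ y → v ⊏ y → y ⊑ z → y ≡ z
  ⋖Q-upper-minimal {v} {y} {z} (_ , _ , _ , between) y∈Q v⊏y y⊑z with y ≟V z
  ... | yes y≡z = y≡z
  ... | no y≢z = ⊥-elim (between y y∈Q v⊏y (y⊑z , y≢z))

  oneValue-shape : ∀ {v} p → InQ v → p ≢ 𝟘 → (∃[ i ] (v ! i ≡ p)) → (∀ i → v ! i ≡ 𝟘 ⊎ v ! i ≡ p) →
                   ∃[ a ] (v ≡ blocks (toℕ a) 𝟘 p)
  oneValue-shape {v} p (chain , _) p≢𝟘 (i₀ , vᵢ₀≡p) values
    with upward-closed-threshold m (λ l → v ! l ≡ p) (λ l → v ! l ≟ p) upward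
    where
    upward : ∀ l l′ → v ! l ≡ p → toℕ l ≤ toℕ l′ → v ! l′ ≡ p
    upward l l′ vₗ≡p l≤l′ with values l′
    ... | inj₂ e = e
    ... | inj₁ vₗ′≡𝟘 = ⊥-elim (p≢𝟘 (≤-antisym (subst₂ _≤P_ vₗ≡p vₗ′≡𝟘 (chain l l′ l≤l′)) (𝟘-least p)))
  ... | a , threshold = fromℕ< a<m , vec-ext v _ agree
    where
    a<m : a < m
    a<m = ℕ.≤-<-trans (proj₁ (threshold i₀) vᵢ₀≡p) (Fin.toℕ<n i₀)
    a≡ : toℕ (fromℕ< a<m) ≡ a
    a≡ = Fin.toℕ-fromℕ< a<m
    agree : ∀ l → v ! l ≡ blocks (toℕ (fromℕ< a<m)) 𝟘 p ! l
    agree l with toℕ l ℕ.<? a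
    ... | yes l<a = trans (below (values l)) (sym (blocks-< l (subst (toℕ l <_) (sym a≡) l<a)))
      where below : v ! l ≡ 𝟘 ⊎ v ! l ≡ p → v ! l ≡ 𝟘
            below (inj₁ e) = e
            below (inj₂ e) = ⊥-elim (ℕ.<⇒≱ l<a (proj₁ (threshold l) e))
    ... | no l≮a = trans (proj₂ (threshold l) (ℕ.≮⇒≥ l≮a)) (sym (blocks-≥ l (subst (_≤ toℕ l) (sym a≡) (ℕ.≮⇒≥ l≮a))))

  record PairShape (v : V) (p q : Carrier) : Set where
    field
      ia ib : Fin m
      ia<ib : toℕ ia < toℕ ib
      is-𝟘 : ∀ l → toℕ l < toℕ ia → v ! l ≡ 𝟘
      is-p : ∀ l → toℕ ia ≤ toℕ l → toℕ l < toℕ ib → v ! l ≡ p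
      is-q : ∀ l → toℕ ib ≤ toℕ l → v ! l ≡ q

    values : ∀ l → OneOf p q (v ! l)
    values l with toℕ l ℕ.<? toℕ ia | toℕ l ℕ.<? toℕ ib
    ... | yes l<ia | _ = inj₁ (is-𝟘 l l<ia)
    ... | no l≮ia | yes l<ib = inj₂ (inj₁ (is-p l (ℕ.≮⇒≥ l≮ia) l<ib))
    ... | no _ | no l≮ib = inj₂ (inj₂ (is-q l (ℕ.≮⇒≥ l≮ib)))

  twoValues-shape : ∀ {v} p q → InQ v → p ⋖ q → p ≢ 𝟘 → (∃[ i ] (v ! i ≡ p)) → (∃[ i ] (v ! i ≡ q)) →
                    (∀ i → OneOf p q (v ! i)) → PairShape v p q
  twoValues-shape {v} p q (chain , _) p⋖q p≢𝟘 (ip , vip≡p) (iq , viq≡q) values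
    with upward-closed-threshold m (λ l → v ! l ≢ 𝟘) (λ l → ¬? (v ! l ≟ 𝟘)) nonzero-upward
       | upward-closed-threshold m (λ l → v ! l ≡ q) (λ l → v ! l ≟ q) q-upward
    where
    nonzero-upward : ∀ l l′ → v ! l ≢ 𝟘 → toℕ l ≤ toℕ l′ → v ! l′ ≢ 𝟘
    nonzero-upward l l′ vₗ≢𝟘 l≤l′ vₗ′≡𝟘 = vₗ≢𝟘 (≤-antisym (subst (v ! l ≤P_) vₗ′≡𝟘 (chain l l′ l≤l′)) (𝟘-least _))
    q-upward : ∀ l l′ → v ! l ≡ q → toℕ l ≤ toℕ l′ → v ! l′ ≡ q
    q-upward l l′ vₗ≡q l≤l′ with values l′
    ... | inj₁ vₗ′≡𝟘 = ⊥-elim (≺⇒≱ (≤-≺-trans (𝟘-least p) (⋖⇒≺ p⋖q)) (subst₂ _≤P_ vₗ≡q vₗ′≡𝟘 (chain l l′ l≤l′)))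
    ... | inj₂ (inj₁ vₗ′≡p) = ⊥-elim (≺⇒≱ (⋖⇒≺ p⋖q) (subst₂ _≤P_ vₗ≡q vₗ′≡p (chain l l′ l≤l′)))
    ... | inj₂ (inj₂ vₗ′≡q) = vₗ′≡q
  ... | a , nonzero-from-a | b , q-from-b = record
    { ia = fromℕ< a<m ; ib = fromℕ< b<m ; ia<ib = subst₂ _<_ (sym a≡) (sym b≡) (ℕ.≤-<-trans a≤ip ip<b)
    ; is-𝟘 = is-𝟘 ; is-p = is-p ; is-q = λ l b≤l → proj₂ (q-from-b l) (subst (_≤ toℕ l) b≡ b≤l) }
    where
    a≤ip : a ≤ toℕ ip
    a≤ip = proj₁ (nonzero-from-a ip) (λ vip≡𝟘 → p≢𝟘 (trans (sym vip≡p) vip≡𝟘))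
    ip<b : toℕ ip < b
    ip<b with toℕ ip ℕ.<? b
    ... | yes ip<b = ip<b
    ... | no ip≮b = ⊥-elim (proj₂ (⋖⇒≺ p⋖q) (trans (sym vip≡p) (proj₂ (q-from-b ip) (ℕ.≮⇒≥ ip≮b))))
    b<m : b < m
    b<m = ℕ.≤-<-trans (proj₁ (q-from-b iq) viq≡q) (Fin.toℕ<n iq)
    a<m : a < m
    a<m = ℕ.≤-<-trans a≤ip (Fin.toℕ<n ip)
    a≡ : toℕ (fromℕ< a<m) ≡ a
    a≡ = Fin.toℕ-fromℕ< a<m
    b≡ : toℕ (fromℕ< b<m) ≡ b
    b≡ = Fin.toℕ-fromℕ< b<m
    is-𝟘 : ∀ l → toℕ l < toℕ (fromℕ< a<m) → v ! l ≡ 𝟘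
    is-𝟘 l l<a with v ! l ≟ 𝟘
    ... | yes vₗ≡𝟘 = vₗ≡𝟘
    ... | no vₗ≢𝟘 = ⊥-elim (ℕ.<⇒≱ l<a (subst (_≤ toℕ l) (sym a≡) (proj₁ (nonzero-from-a l) vₗ≢𝟘)))
    is-p : ∀ l → toℕ (fromℕ< a<m) ≤ toℕ l → toℕ l < toℕ (fromℕ< b<m) → v ! l ≡ p
    is-p l a≤l l<b with values l
    ... | inj₁ vₗ≡𝟘 = ⊥-elim (proj₂ (nonzero-from-a l) (subst (_≤ toℕ l) a≡ a≤l) vₗ≡𝟘)
    ... | inj₂ (inj₁ vₗ≡p) = vₗ≡p
    ... | inj₂ (inj₂ vₗ≡q) = ⊥-elim (ℕ.<⇒≱ l<b (subst (_≤ toℕ l) (sym b≡) (proj₁ (q-from-b l) vₗ≡q)))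

  previous : (i : Fin m) → 0 < toℕ i → Fin m
  previous (Fin.suc b) _ = inject₁ b

  suc-previous : ∀ i (0<i : 0 < toℕ i) → suc (toℕ (previous i 0<i)) ≡ toℕ i
  suc-previous (Fin.suc b) _ = cong suc (Fin.toℕ-inject₁ b)

  previous< : ∀ i (0<i : 0 < toℕ i) → toℕ (previous i 0<i) < toℕ i
  previous< i 0<i = subst (toℕ (previous i 0<i) <_) (suc-previous i 0<i) (ℕ.n<1+n _)

  module PairShapeMoves {v p q} (v∈Q : InQ v) (p⋖q : p ⋖ q) (p≢𝟘 : p ≢ 𝟘) (shape : PairShape v p q) where
    open PairShape shape

    first-p : v ! ia ≡ p
    first-p = is-p ia ℕ.≤-refl ia<ib

    first-q : v ! ib ≡ q
    first-q = is-q ib ℕ.≤-refl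

    ib≢ia : ib ≢ ia
    ib≢ia e = ℕ.<-irrefl (cong toℕ (sym e)) ia<ib

    lower-first-q : (v [ ib ]≔ p) ⋖Q v
    lower-first-q = single-coordinate-⋖ ib lowered-inQ v∈Q (λ l l≢ib → update-elsewhere v ib p l l≢ib)
      (subst₂ _⋖_ (sym (update-here v ib p)) (sym first-q) p⋖q)
      where
      below : ∀ l → toℕ l < toℕ ib → v ! l ≤P p
      below l l<ib with toℕ l ℕ.<? toℕ ia
      ... | yes l<ia = subst (_≤P p) (sym (is-𝟘 l l<ia)) (𝟘-least p)
      ... | no l≮ia = subst (_≤P p) (sym (is-p l (ℕ.≮⇒≥ l≮ia) l<ib)) (≤-refl p)
      lowered-inQ : InQ (v [ ib ]≔ p)
      lowered-inQ = update-inQ {v} ib p p⋖q (proj₁ v∈Q) below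
        (λ l ib<l → subst (p ≤P_) (sym (is-q l (ℕ.<⇒≤ ib<l))) (proj₁ (⋖⇒≺ p⋖q)))
        (inj₂ (inj₁ refl)) (λ l _ → values l)

    erase-first-p : (v [ ia ]≔ 𝟘) ⋖Q v
    erase-first-p = single-coordinate-cover ia erased-inQ v∈Q (λ l l≢ia → update-elsewhere v ia 𝟘 l l≢ia)
      (subst₂ _≺P_ (sym (update-here v ia 𝟘)) (sym first-p) (𝟘≺ p≢𝟘)) nothing-between
      where
      erased-inQ : InQ (v [ ia ]≔ 𝟘)
      erased-inQ = update-inQ {v} ia 𝟘 p⋖q (proj₁ v∈Q)
        (λ l l<ia → subst (_≤P 𝟘) (sym (is-𝟘 l l<ia)) (≤-refl 𝟘)) (λ l _ → 𝟘-least _)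
        (inj₁ refl) (λ l _ → values l)
      -- Such a z would have the values z ! ia ≺ p and q, which are not related by a cover.
      nothing-between : ∀ z → InQ z → (∀ j → j ≢ ia → z ! j ≡ (v [ ia ]≔ 𝟘) ! j) →
                        (v [ ia ]≔ 𝟘) ! ia ≺P z ! ia → ¬ (z ! ia ≺P v ! ia)
      nothing-between z z∈Q same 𝟘≺zₐ zₐ≺vₐ = ¬cover (distinct-nonzero⇒⋖ {z} z∈Q ia ib zₐ≢𝟘 z_b≢𝟘 zₐ≢z_b)
        where
        z_b≡q : z ! ib ≡ q
        z_b≡q = trans (same ib ib≢ia) (trans (update-elsewhere v ia 𝟘 ib ib≢ia) first-q)
        zₐ≺p : z ! ia ≺P p
        zₐ≺p = subst (z ! ia ≺P_) first-p zₐ≺vₐ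
        zₐ≢𝟘 : z ! ia ≢ 𝟘
        zₐ≢𝟘 e = proj₂ 𝟘≺zₐ (trans (update-here v ia 𝟘) (sym e))
        z_b≢𝟘 : z ! ib ≢ 𝟘
        z_b≢𝟘 e = ⋖-upper≢𝟘 p⋖q (trans (sym z_b≡q) e)
        zₐ≢z_b : z ! ia ≢ z ! ib
        zₐ≢z_b e = ≺-irrefl (≺-trans zₐ≺p (subst (p ≺P_) (sym (trans e z_b≡q)) (⋖⇒≺ p⋖q)))
        ¬cover : ¬ (z ! ia ⋖ z ! ib ⊎ z ! ib ⋖ z ! ia)
        ¬cover (inj₁ zₐ⋖z_b) = ⋖-nothing-between (subst (z ! ia ⋖_) z_b≡q zₐ⋖z_b) zₐ≺p (⋖⇒≺ p⋖q)
        ¬cover (inj₂ z_b⋖zₐ) = ≺⇒≱ (≺-trans (subst (_≺P z ! ia) z_b≡q (⋖⇒≺ z_b⋖zₐ)) zₐ≺p) (proj₁ (⋖⇒≺ p⋖q))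

    0<ib : 0 < toℕ ib
    0<ib = ℕ.≤-<-trans z≤n ia<ib

    last-p : Fin m
    last-p = previous ib 0<ib

    ia≤last-p : toℕ ia ≤ toℕ last-p
    ia≤last-p = ℕ.≤-pred (subst (toℕ ia <_) (sym (suc-previous ib 0<ib)) ia<ib)

    v-last-p : v ! last-p ≡ p
    v-last-p = is-p last-p ia≤last-p (previous< ib 0<ib)

    raise-last-p : v ⋖Q (v [ last-p ]≔ q)
    raise-last-p = single-coordinate-⋖ last-p v∈Q raised-inQ (λ l l≢ → sym (update-elsewhere v last-p q l l≢))
      (subst₂ _⋖_ (sym v-last-p) (sym (update-here v last-p q)) p⋖q)
      where
      raised-inQ : InQ (v [ last-p ]≔ q)
      raised-inQ = update-inQ {v} last-p q p⋖q (proj₁ v∈Q) (λ l _ → OneOf-≤ p⋖q (values l))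
        (λ l last-p<l → subst (q ≤P_) (sym (is-q l (subst (_≤ toℕ l) (suc-previous ib 0<ib) last-p<l))) (≤-refl q))
        (inj₂ (inj₂ refl)) (λ l _ → values l)

    module _ (0<ia : 0 < toℕ ia) where

      last-𝟘 : Fin m
      last-𝟘 = previous ia 0<ia

      v-last-𝟘 : v ! last-𝟘 ≡ 𝟘
      v-last-𝟘 = is-𝟘 last-𝟘 (previous< ia 0<ia)

      last-𝟘<ia : toℕ last-𝟘 < toℕ ia
      last-𝟘<ia = previous< ia 0<ia

      raised-𝟘-inQ : InQ (v [ last-𝟘 ]≔ p)
      raised-𝟘-inQ = update-inQ {v} last-𝟘 p p⋖q (proj₁ v∈Q)
        (λ l l<last-𝟘 → subst (_≤P p) (sym (is-𝟘 l (ℕ.<-trans l<last-𝟘 last-𝟘<ia))) (𝟘-least p)) above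
        (inj₂ (inj₁ refl)) (λ l _ → values l)
        where
        above : ∀ l → toℕ last-𝟘 < toℕ l → p ≤P v ! l
        above l last-𝟘<l with toℕ l ℕ.<? toℕ ib
        ... | yes l<ib = subst (p ≤P_) (sym (is-p l (subst (_≤ toℕ l) (suc-previous ia 0<ia) last-𝟘<l) l<ib)) (≤-refl p)
        ... | no l≮ib = subst (p ≤P_) (sym (is-q l (ℕ.≮⇒≥ l≮ib))) (proj₁ (⋖⇒≺ p⋖q))

      -- A z strictly between would carry three distinct nonzero values z ! last-𝟘 ≺ p ⋖ q.
      raise-last-𝟘 : v ⋖Q (v [ last-𝟘 ]≔ p)
      raise-last-𝟘 = single-coordinate-cover last-𝟘 v∈Q raised-𝟘-inQ (λ l l≢ → sym (update-elsewhere v last-𝟘 p l l≢))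
        (subst₂ _≺P_ (sym v-last-𝟘) (sym (update-here v last-𝟘 p)) (𝟘≺ p≢𝟘)) nothing-between
        where
        ia≢last-𝟘 : ia ≢ last-𝟘
        ia≢last-𝟘 e = ℕ.<-irrefl (cong toℕ (sym e)) last-𝟘<ia
        ib≢last-𝟘 : ib ≢ last-𝟘
        ib≢last-𝟘 e = ℕ.<-irrefl (cong toℕ (sym e)) (ℕ.<-trans last-𝟘<ia ia<ib)
        nothing-between : ∀ z → InQ z → (∀ j → j ≢ last-𝟘 → z ! j ≡ v ! j) → v ! last-𝟘 ≺P z ! last-𝟘 →
                          ¬ (z ! last-𝟘 ≺P (v [ last-𝟘 ]≔ p) ! last-𝟘)
        nothing-between z z∈Q same 𝟘≺z′ z′≺p′ =
          ¬three-distinct-nonzero {z} z∈Q last-𝟘 ia ib z′≢𝟘 zₐ≢𝟘 z_b≢𝟘 z′≢zₐ z′≢z_b zₐ≢z_b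
          where
          z′≺p : z ! last-𝟘 ≺P p
          z′≺p = subst (z ! last-𝟘 ≺P_) (update-here v last-𝟘 p) z′≺p′
          zₐ≡p : z ! ia ≡ p
          zₐ≡p = trans (same ia ia≢last-𝟘) first-p
          z_b≡q : z ! ib ≡ q
          z_b≡q = trans (same ib ib≢last-𝟘) first-q
          z′≢𝟘 : z ! last-𝟘 ≢ 𝟘
          z′≢𝟘 e = proj₂ 𝟘≺z′ (trans v-last-𝟘 (sym e))
          zₐ≢𝟘 : z ! ia ≢ 𝟘
          zₐ≢𝟘 e = p≢𝟘 (trans (sym zₐ≡p) e)
          z_b≢𝟘 : z ! ib ≢ 𝟘
          z_b≢𝟘 e = ⋖-upper≢𝟘 p⋖q (trans (sym z_b≡q) e)
          z′≢zₐ : z ! last-𝟘 ≢ z ! ia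
          z′≢zₐ e = ≺-irrefl (subst (_≺P p) (trans e zₐ≡p) z′≺p)
          z′≢z_b : z ! last-𝟘 ≢ z ! ib
          z′≢z_b e = ≺-irrefl (≺-trans (subst (_≺P p) (trans e z_b≡q) z′≺p) (⋖⇒≺ p⋖q))
          zₐ≢z_b : z ! ia ≢ z ! ib
          zₐ≢z_b e = proj₂ (⋖⇒≺ p⋖q) (trans (sym zₐ≡p) (trans e z_b≡q))

  raise-last : ∀ {v p q} → InQ v → p ⋖ q → v ! last ≡ p → (∀ l → OneOf p q (v ! l)) → v ⋖Q (v [ last ]≔ q)
  raise-last {v} {p} {q} v∈Q p⋖q v-last values = single-coordinate-⋖ last v∈Q raised-inQ
    (λ l l≢last → sym (update-elsewhere v last q l l≢last))
    (subst₂ _⋖_ (sym v-last) (sym (update-here v last q)) p⋖q)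
    where
    raised-inQ : InQ (v [ last ]≔ q)
    raised-inQ = update-inQ {v} last q p⋖q (proj₁ v∈Q) (λ l _ → OneOf-≤ p⋖q (values l))
      (λ l last<l → ⊥-elim (ℕ.<⇒≱ last<l (≤-last l))) (inj₂ (inj₂ refl)) (λ l _ → values l)

module JoinIrreducibles (P : FinBoundedPoset) (n : ℕ) where
  open FinBoundedPoset P
  open FinitePoset P
  open MCoverPoset P n

  lower-at : ∀ (a : Fin m) j c → c ⋖ j → (blocks (toℕ a) 𝟘 j [ a ]≔ c) ⋖Q blocks (toℕ a) 𝟘 j
  lower-at a j c c⋖j = single-coordinate-⋖ a lowered-inQ (blocks𝟘-inQ j) (λ l l≢a → update-elsewhere v a c l l≢a)
    (subst₂ _⋖_ (sym (update-here v a c)) (sym (blocks-≥ a ℕ.≤-refl)) c⋖j)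
    where
    v : V
    v = blocks (toℕ a) 𝟘 j
    lowered-inQ : InQ (v [ a ]≔ c)
    lowered-inQ = update-inQ {v} a c c⋖j (proj₁ (blocks𝟘-inQ j))
      (λ l l<a → subst (_≤P c) (sym (blocks-< l l<a)) (𝟘-least _))
      (λ l a<l → subst (c ≤P_) (sym (blocks-≥ l (ℕ.<⇒≤ a<l))) (proj₁ (⋖⇒≺ c⋖j)))
      (inj₂ (inj₁ refl)) (λ l _ → [ inj₁ , inj₂ ∘ inj₂ ]′ (blocks-values l))

  -- Any lower cover z of v drops some coordinate ≥ a, and by the multichain condition
  -- it drops coordinate a itself, below the unique lower cover of j.
  blocks𝟘-joinIrr : ∀ (a : Fin m) {j} → JoinIrr SP j → JoinIrr Q (blocks (toℕ a) 𝟘 j)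
  blocks𝟘-joinIrr a {j} j-irr@(_ , _ , (j′ , j′⋖j , only)) =
    blocks𝟘-inQ j , ¬minimal , (lowered , lowered⋖v , unique)
    where
    v : V
    v = blocks (toℕ a) 𝟘 j
    lowered : V
    lowered = v [ a ]≔ j′
    lowered⋖v : lowered ⋖Q v
    lowered⋖v = lower-at a j j′ j′⋖j
    ¬minimal : ¬ Minimal Q v
    ¬minimal (_ , minimal) = minimal (constant 𝟘) (constant-inQ 𝟘) (proj₂ constant𝟘-least v (blocks𝟘-inQ j) ,
      λ 𝟘≡v → joinIrr⇒≢𝟘 j-irr (trans (sym (blocks-≥ last (≤-last a))) (trans (cong (_! last) (sym 𝟘≡v)) (constant-lookup 𝟘 last))))
    unique : ∀ z → z ⋖Q v → z ≡ lowered
    unique z z⋖v@(z∈Q , _ , (z⊑v , z≢v) , _) = ⋖Q-lower-maximal z⋖v (proj₁ lowered⋖v) (proj₁ (proj₂ (proj₂ lowered⋖v))) z⊑lowered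
      where
      zₐ≤j′ : z ! a ≤P j′
      zₐ≤j′ with z ! a ≟ j
      ... | yes zₐ≡j = ⊥-elim (z≢v (vec-ext z v agree))
        where agree : ∀ l → z ! l ≡ v ! l
              agree l with blocks-view (toℕ a) 𝟘 j l
              ... | inj₁ (_ , e) = ≤-antisym (z⊑v l) (subst (_≤P z ! l) (sym e) (𝟘-least _))
              ... | inj₂ (a≤l , e) = ≤-antisym (z⊑v l) (subst (_≤P z ! l) (trans zₐ≡j (sym e)) (proj₁ z∈Q a l a≤l))
      ... | no zₐ≢j with cover-below (subst (z ! a ≤P_) (blocks-≥ a ℕ.≤-refl) (z⊑v a) , zₐ≢j)
      ... | c , zₐ≤c , c⋖j = subst (z ! a ≤P_) (only c c⋖j) zₐ≤c
      z⊑lowered : z ⊑ lowered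
      z⊑lowered l with l Fin.≟ a
      ... | yes refl = subst (z ! a ≤P_) (sym (update-here v a j′)) zₐ≤j′
      ... | no l≢a = subst (z ! l ≤P_) (sym (update-elsewhere v a j′ l l≢a)) (z⊑v l)

  joinIrr-of-blocks𝟘 : ∀ (a : Fin m) p → p ≢ 𝟘 → JoinIrr Q (blocks (toℕ a) 𝟘 p) → JoinIrr SP p
  joinIrr-of-blocks𝟘 a p p≢𝟘 (_ , _ , (_ , _ , only)) with cover-below (𝟘≺ p≢𝟘)
  ... | c , _ , c⋖p = tt , (λ minimal → proj₂ minimal 𝟘 tt (𝟘≺ p≢𝟘)) , (c , c⋖p , λ c′ c′⋖p →
        trans (sym (update-here v a c′))
              (trans (cong (_! a) (trans (only _ (lower-at a p c′ c′⋖p)) (sym (only _ (lower-at a p c c⋖p)))))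
                     (update-here v a c)))
    where v : V
          v = blocks (toℕ a) 𝟘 p

  joinIrrQ-shape : ∀ {v} → JoinIrr Q v → ∃[ j ] ∃[ a ] (JoinIrr SP j × v ≡ blocks (toℕ a) 𝟘 j)
  joinIrrQ-shape {v} v-irr@(v∈Q , ¬minimal , (_ , _ , only)) with coverCond-view {v} (proj₂ v∈Q)
  ... | allZero all-𝟘 = ⊥-elim (¬minimal (v∈Q , λ y _ (y⊑v , y≢v) →
        y≢v (vec-ext y v (λ i → trans (≤-antisym (subst (y ! i ≤P_) (all-𝟘 i) (y⊑v i)) (𝟘-least _)) (sym (all-𝟘 i))))))
  ... | oneValue p p≢𝟘 p∈v values with oneValue-shape {v} p v∈Q p≢𝟘 p∈v values
  ... | a , v≡ = p , a , joinIrr-of-blocks𝟘 a p p≢𝟘 (subst (JoinIrr Q) v≡ v-irr) , v≡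
  joinIrrQ-shape {v} (v∈Q , _ , (_ , _ , only)) | twoValues p q p⋖q p≢𝟘 p∈v q∈v values
    = ⊥-elim (p≢𝟘 (begin
      p                              ≡⟨ sym (trans (update-elsewhere v ib p ia (λ e → ib≢ia (sym e))) first-p) ⟩
      (v [ ib ]≔ p) ! ia             ≡⟨ cong (_! ia) (trans (only _ lower-first-q) (sym (only _ erase-first-p))) ⟩
      (v [ ia ]≔ 𝟘) ! ia             ≡⟨ update-here v ia 𝟘 ⟩
      𝟘                              ∎))
    where
    shape : PairShape v p q
    shape = twoValues-shape {v} p q v∈Q p⋖q p≢𝟘 p∈v q∈v values
    open PairShape shape using (ia; ib)
    open PairShapeMoves v∈Q p⋖q p≢𝟘 shape

  blocks𝟘-injective : ∀ {j j′ a a′} → JoinIrr SP j → JoinIrr SP j′ →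
                      blocks (toℕ a) 𝟘 j ≡ blocks (toℕ a′) 𝟘 j′ → j ≡ j′ × a ≡ a′
  blocks𝟘-injective {j} {j′} {a} {a′} j-irr j′-irr eq = j≡j′ , Fin.toℕ-injective a≡a′
    where
    j≡j′ : j ≡ j′
    j≡j′ = trans (sym (blocks-≥ last (≤-last a))) (trans (cong (_! last) eq) (blocks-≥ last (≤-last a′)))
    a≡a′ : toℕ a ≡ toℕ a′
    a≡a′ with ℕ.<-cmp (toℕ a) (toℕ a′)
    ... | tri≈ _ e _ = e
    ... | tri< a<a′ _ _ = ⊥-elim (joinIrr⇒≢𝟘 j-irr (trans (sym (blocks-≥ a ℕ.≤-refl)) (trans (cong (_! a) eq) (blocks-< a a<a′))))
    ... | tri> _ _ a′<a = ⊥-elim (joinIrr⇒≢𝟘 j′-irr (trans (sym (blocks-≥ a′ ℕ.≤-refl)) (trans (cong (_! a′) (sym eq)) (blocks-< a′ a′<a))))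

  hasCard-joinIrr-mcover : ∀ {k} → HasCard (JoinIrr SP) k → HasCard (JoinIrr Q) (m * k)
  hasCard-joinIrr-mcover {k} card = subst (HasCard (JoinIrr Q)) (ℕ.*-comm k m)
    (hasCard-cong (λ { v (j , a , j-irr , refl) → blocks𝟘-joinIrr a j-irr }) (λ v → joinIrrQ-shape)
      (hasCard-image₂ (λ j a → blocks (toℕ a) 𝟘 j) blocks𝟘-injective card))

module MeetIrreducibles (P : FinBoundedPoset) (n : ℕ) where
  open FinBoundedPoset P
  open FinitePoset P
  open MCoverPoset P n
  open JoinIrreducibles P n

  meetIrr-intro : ∀ {v Y} → v ⋖Q Y → (∀ z → v ⋖Q z → Y ⊑ z) → MeetIrr Q v
  meetIrr-intro {v} {Y} v⋖Y@(v∈Q , Y∈Q , v⊏Y , _) least =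
    v∈Q , (λ maximal → proj₂ maximal Y Y∈Q v⊏Y) , (Y , v⋖Y , λ z v⋖z → sym (⋖Q-upper-minimal v⋖z Y∈Q v⊏Y (least z v⋖z)))

  update-⊑ : ∀ {v z} i c → v ⊑ z → c ≤P z ! i → (v [ i ]≔ c) ⊑ z
  update-⊑ {v} {z} i c v⊑z c≤zᵢ l with l Fin.≟ i
  ... | yes refl = subst (_≤P z ! i) (sym (update-here v i c)) c≤zᵢ
  ... | no l≢i = subst (_≤P z ! l) (sym (update-elsewhere v i c l l≢i)) (v⊑z l)

  meetIrr-of-constant : ∀ p → MeetIrr Q (constant p) → MeetIrr SP p
  meetIrr-of-constant p (_ , _ , (Y , p⋖Y , only)) with differing-coordinate (constant p) Y (proj₂ (proj₁ (proj₂ (proj₂ p⋖Y))))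
  ... | l , pₗ≢Yₗ with cover-above {p} {Y ! l} (subst (_≤P Y ! l) (constant-lookup p l) (proj₁ (proj₁ (proj₂ (proj₂ p⋖Y))) l) ,
                                                 λ e → pₗ≢Yₗ (trans (constant-lookup p l) e))
  ... | c , p⋖c , _ = tt , (λ maximal → proj₂ maximal c tt (⋖⇒≺ p⋖c)) , (c , p⋖c , λ c′ p⋖c′ →
        trans (sym (update-here (constant p) last c′))
              (trans (cong (_! last) (trans (only _ (raise p⋖c′)) (sym (only _ (raise p⋖c)))))
                     (update-here (constant p) last c)))
    where raise : ∀ {c} → p ⋖ c → constant p ⋖Q (constant p [ last ]≔ c)
          raise p⋖c = raise-last (constant-inQ p) p⋖c (constant-lookup p last) (λ l → inj₂ (inj₁ (constant-lookup p l)))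

  module LastZero (a : Fin n) (p : Carrier) where
    v : V
    v = blocks (suc (toℕ a)) 𝟘 p
    i₀ : Fin m
    i₀ = inject₁ a
    i₀≡a : toℕ i₀ ≡ toℕ a
    i₀≡a = Fin.toℕ-inject₁ a
    v-i₀ : v ! i₀ ≡ 𝟘
    v-i₀ = blocks-< i₀ (s≤s (ℕ.≤-reflexive i₀≡a))
    v-after : ∀ l → toℕ i₀ < toℕ l → v ! l ≡ p
    v-after l i₀<l = blocks-≥ l (subst (λ t → suc t ≤ toℕ l) i₀≡a i₀<l)
    v-before : ∀ l → toℕ l < toℕ i₀ → v ! l ≡ 𝟘
    v-before l l<i₀ = blocks-< l (ℕ.<-trans (subst (toℕ l <_) i₀≡a l<i₀) (ℕ.n<1+n _))
    i₀<last : toℕ i₀ < toℕ last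
    i₀<last = subst₂ _<_ (sym i₀≡a) (sym toℕ-last) (Fin.toℕ<n a)
    last≢i₀ : last ≢ i₀
    last≢i₀ e = ℕ.<-irrefl (cong toℕ (sym e)) i₀<last
    v-last : v ! last ≡ p
    v-last = v-after last i₀<last
    v∈Q : InQ v
    v∈Q = blocks𝟘-inQ p

    w : Carrier → V
    w c = v [ i₀ ]≔ c

    w-inQ : ∀ {c} → c ⋖ p ⊎ (c ≡ p × 𝟘 ⋖ p) → InQ (w c)
    w-inQ {c} (inj₁ c⋖p) = update-inQ {v} i₀ c c⋖p (proj₁ v∈Q)
      (λ l l<i₀ → subst (_≤P c) (sym (v-before l l<i₀)) (𝟘-least c))
      (λ l i₀<l → subst (c ≤P_) (sym (v-after l i₀<l)) (proj₁ (⋖⇒≺ c⋖p)))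
      (inj₂ (inj₁ refl)) (λ l _ → [ inj₁ , inj₂ ∘ inj₂ ]′ (blocks-values l))
    w-inQ (inj₂ (refl , 𝟘⋖p)) = update-inQ {v} i₀ p 𝟘⋖p (proj₁ v∈Q)
      (λ l l<i₀ → subst (_≤P p) (sym (v-before l l<i₀)) (𝟘-least p))
      (λ l i₀<l → subst (p ≤P_) (sym (v-after l i₀<l)) (≤-refl p))
      (inj₂ (inj₂ refl)) (λ l _ → [ inj₁ , inj₂ ∘ inj₂ ]′ (blocks-values l))

    -- Nothing of Q fits between, as its coordinates i₀ and last would carry 𝟘 ≺ z ! i₀ ≺ c and p.
    raise : ∀ {c} → c ⋖ p → c ≢ 𝟘 → v ⋖Q w c
    raise {c} c⋖p c≢𝟘 = single-coordinate-cover i₀ v∈Q (w-inQ (inj₁ c⋖p)) (λ l l≢i₀ → sym (update-elsewhere v i₀ c l l≢i₀))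
      (subst₂ _≺P_ (sym v-i₀) (sym (update-here v i₀ c)) (𝟘≺ c≢𝟘)) nothing-between
      where
      nothing-between : ∀ z → InQ z → (∀ j → j ≢ i₀ → z ! j ≡ v ! j) → v ! i₀ ≺P z ! i₀ → ¬ (z ! i₀ ≺P w c ! i₀)
      nothing-between z z∈Q same 𝟘≺zᵢ₀ zᵢ₀≺wᵢ₀ = ¬cover (distinct-nonzero⇒⋖ {z} z∈Q i₀ last zᵢ₀≢𝟘 z-last≢𝟘 zᵢ₀≢z-last)
        where
        z-last : z ! last ≡ p
        z-last = trans (same last last≢i₀) v-last
        zᵢ₀≺c : z ! i₀ ≺P c
        zᵢ₀≺c = subst (z ! i₀ ≺P_) (update-here v i₀ c) zᵢ₀≺wᵢ₀
        zᵢ₀≢𝟘 : z ! i₀ ≢ 𝟘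
        zᵢ₀≢𝟘 e = proj₂ 𝟘≺zᵢ₀ (trans v-i₀ (sym e))
        z-last≢𝟘 : z ! last ≢ 𝟘
        z-last≢𝟘 e = ⋖-upper≢𝟘 c⋖p (trans (sym z-last) e)
        zᵢ₀≢z-last : z ! i₀ ≢ z ! last
        zᵢ₀≢z-last e = ≺-irrefl (≺-trans zᵢ₀≺c (subst (c ≺P_) (sym (trans e z-last)) (⋖⇒≺ c⋖p)))
        ¬cover : ¬ (z ! i₀ ⋖ z ! last ⊎ z ! last ⋖ z ! i₀)
        ¬cover (inj₁ zᵢ₀⋖z-last) = ⋖-nothing-between (subst (z ! i₀ ⋖_) z-last zᵢ₀⋖z-last) zᵢ₀≺c (⋖⇒≺ c⋖p)
        ¬cover (inj₂ z-last⋖zᵢ₀) = ≺⇒≱ (≺-trans (subst (_≺P z ! i₀) z-last (⋖⇒≺ z-last⋖zᵢ₀)) zᵢ₀≺c) (proj₁ (⋖⇒≺ c⋖p))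

    raise-to-p : 𝟘 ⋖ p → v ⋖Q w p
    raise-to-p 𝟘⋖p = single-coordinate-⋖ i₀ v∈Q (w-inQ (inj₂ (refl , 𝟘⋖p))) (λ l l≢i₀ → sym (update-elsewhere v i₀ p l l≢i₀))
      (subst₂ _⋖_ (sym v-i₀) (sym (update-here v i₀ p)) 𝟘⋖p)

    raise-to-lower-cover : p ≢ 𝟘 → ∃[ c ] (v ⋖Q w c)
    raise-to-lower-cover p≢𝟘 with cover-below (𝟘≺ p≢𝟘)
    ... | c , _ , c⋖p with c ≟ 𝟘
    ... | yes c≡𝟘 = p , raise-to-p (subst (_⋖ p) c≡𝟘 c⋖p)
    ... | no c≢𝟘 = c , raise c⋖p c≢𝟘

    above-nonzero-at-i₀ : ∀ {z} → p ≡ 𝟙 → InQ z → v ⊏ z → z ! i₀ ≢ 𝟘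
    above-nonzero-at-i₀ {z} p≡𝟙 z∈Q (v⊑z , v≢z) zᵢ₀≡𝟘 with differing-coordinate v z v≢z
    ... | l , vₗ≢zₗ with toℕ i₀ ℕ.<? toℕ l
    ... | yes i₀<l = vₗ≢zₗ (trans (v-after l i₀<l) (trans p≡𝟙
                       (≤-antisym (subst (_≤P z ! l) (trans (v-after l i₀<l) p≡𝟙) (v⊑z l)) (𝟙-greatest _))))
    ... | no i₀≮l = vₗ≢zₗ (trans vₗ≡𝟘 (sym zₗ≡𝟘))
      where
      zₗ≤𝟘 : z ! l ≤P 𝟘
      zₗ≤𝟘 = subst (z ! l ≤P_) zᵢ₀≡𝟘 (proj₁ z∈Q l i₀ (ℕ.≮⇒≥ i₀≮l))
      zₗ≡𝟘 : z ! l ≡ 𝟘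
      zₗ≡𝟘 = ≤-antisym zₗ≤𝟘 (𝟘-least _)
      vₗ≡𝟘 : v ! l ≡ 𝟘
      vₗ≡𝟘 = ≤-antisym (≤-trans (v⊑z l) zₗ≤𝟘) (𝟘-least _)

  module UpperCoverBlock (x : Carrier) (a : Fin m) (x-irr : MeetIrr SP x) where
    y : Carrier
    y = upperCover x
    x⋖y : x ⋖ y
    x⋖y = upperCover-⋖ x-irr
    v : V
    v = blocks (suc (toℕ a)) x y
    v∈Q : InQ v
    v∈Q = blocks-inQ x⋖y
    v-upto : ∀ l → toℕ l ≤ toℕ a → v ! l ≡ x
    v-upto l l≤a = blocks-< l (s≤s l≤a)
    v-after : ∀ l → toℕ a < toℕ l → v ! l ≡ y
    v-after l a<l = blocks-≥ l a<l
    Y : V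
    Y = v [ a ]≔ y

    v⋖Y : v ⋖Q Y
    v⋖Y = single-coordinate-⋖ a v∈Q Y∈Q (λ l l≢a → sym (update-elsewhere v a y l l≢a))
      (subst₂ _⋖_ (sym (v-upto a ℕ.≤-refl)) (sym (update-here v a y)) x⋖y)
      where
      Y∈Q : InQ Y
      Y∈Q = update-inQ {v} a y x⋖y (proj₁ v∈Q)
        (λ l l<a → subst (_≤P y) (sym (v-upto l (ℕ.<⇒≤ l<a))) (proj₁ (⋖⇒≺ x⋖y)))
        (λ l a<l → subst (y ≤P_) (sym (v-after l a<l)) (≤-refl y))
        (inj₂ (inj₂ refl)) (λ l _ → [ inj₂ ∘ inj₁ , inj₂ ∘ inj₂ ]′ (blocks-values l))

    -- Keeping x at a, z would have to raise a later coordinate above x⁺ = y: two values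
    -- x ≺ y ≺ z ! l, not related by a cover.
    cover-moves-a : x ≢ 𝟘 → ∀ {z} → v ⋖Q z → z ! a ≢ x
    cover-moves-a x≢𝟘 {z} (_ , z∈Q , (v⊑z , v≢z) , _) zₐ≡x with differing-coordinate v z v≢z
    ... | l , vₗ≢zₗ with toℕ l ℕ.≤? toℕ a
    ... | yes l≤a = vₗ≢zₗ (≤-antisym (v⊑z l) (subst (z ! l ≤P_) (trans zₐ≡x (sym (v-upto l l≤a))) (proj₁ z∈Q l a l≤a)))
    ... | no l≰a = ¬cover (distinct-nonzero⇒⋖ {z} z∈Q a l zₐ≢𝟘 zₗ≢𝟘 zₐ≢zₗ)
      where
      a<l : toℕ a < toℕ l
      a<l = ℕ.≰⇒> l≰a
      y≺zₗ : y ≺P z ! l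
      y≺zₗ = subst (_≤P z ! l) (v-after l a<l) (v⊑z l) , λ e → vₗ≢zₗ (trans (v-after l a<l) e)
      x≺zₗ : x ≺P z ! l
      x≺zₗ = ≺-trans (⋖⇒≺ x⋖y) y≺zₗ
      zₐ≢𝟘 : z ! a ≢ 𝟘
      zₐ≢𝟘 e = x≢𝟘 (trans (sym zₐ≡x) e)
      zₗ≢𝟘 : z ! l ≢ 𝟘
      zₗ≢𝟘 e = ≺⇒≱ (subst (x ≺P_) e x≺zₗ) (𝟘-least x)
      zₐ≢zₗ : z ! a ≢ z ! l
      zₐ≢zₗ e = ≺-irrefl (subst (_≺P z ! l) (trans (sym zₐ≡x) e) x≺zₗ)
      ¬cover : ¬ (z ! a ⋖ z ! l ⊎ z ! l ⋖ z ! a)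
      ¬cover (inj₁ zₐ⋖zₗ) = ⋖-nothing-between (subst (_⋖ z ! l) zₐ≡x zₐ⋖zₗ) (⋖⇒≺ x⋖y) y≺zₗ
      ¬cover (inj₂ zₗ⋖zₐ) = ≺⇒≱ x≺zₗ (subst (z ! l ≤P_) zₐ≡x (proj₁ (⋖⇒≺ zₗ⋖zₐ)))

  blocks-upperCover-meetIrr : ∀ x (a : Fin m) → MeetIrr SP x → x ≢ 𝟘 → MeetIrr Q (blocks (suc (toℕ a)) x (upperCover x))
  blocks-upperCover-meetIrr x a x-irr x≢𝟘 = meetIrr-intro v⋖Y least
    where
    open UpperCoverBlock x a x-irr
    least : ∀ z → v ⋖Q z → Y ⊑ z
    least z v⋖z@(_ , _ , (v⊑z , _) , _)
      with cover-above (subst (_≤P z ! a) (v-upto a ℕ.≤-refl) (v⊑z a) , λ e → cover-moves-a x≢𝟘 v⋖z (sym e))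
    ... | c , x⋖c , c≤zₐ = update-⊑ {v} {z} a y v⊑z (subst (_≤P z ! a) (meetIrr-cover-unique x-irr x⋖c x⋖y) c≤zₐ)

  -- The last coordinate of an upper cover of 𝟘^m is nonzero, hence lies above the unique cover of 𝟘.
  constant𝟘-meetIrr : MeetIrr SP 𝟘 → MeetIrr Q (constant 𝟘)
  constant𝟘-meetIrr 𝟘-irr = meetIrr-intro 𝟘⋖Y least
    where
    u : Carrier
    u = upperCover 𝟘
    𝟘⋖u : 𝟘 ⋖ u
    𝟘⋖u = upperCover-⋖ 𝟘-irr
    v : V
    v = constant 𝟘
    𝟘⋖Y : v ⋖Q (v [ last ]≔ u)
    𝟘⋖Y = raise-last (constant-inQ 𝟘) 𝟘⋖u (constant-lookup 𝟘 last) (λ l → inj₁ (constant-lookup 𝟘 l))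
    least : ∀ z → v ⋖Q z → (v [ last ]≔ u) ⊑ z
    least z (_ , z∈Q , (v⊑z , v≢z) , _) with differing-coordinate v z v≢z
    ... | l , vₗ≢zₗ with cover-above {𝟘} {z ! last}
          (≺-≤-trans (subst (_≺P z ! l) (constant-lookup 𝟘 l) (v⊑z l , vₗ≢zₗ)) (proj₁ z∈Q l last (≤-last l)))
    ... | c , 𝟘⋖c , c≤z-last = update-⊑ {v} {z} last u v⊑z (subst (_≤P z ! last) (meetIrr-cover-unique 𝟘-irr 𝟘⋖c 𝟘⋖u) c≤z-last)

  -- Above 𝟘^(a+1) 𝟙^(n−a) only coordinate i₀ can grow, and it must reach the unique lower cover of 𝟙 (or 𝟙).
  blocks𝟘𝟙-meetIrr : ∀ (a : Fin n) → JoinIrr SP 𝟙 → MeetIrr Q (blocks (suc (toℕ a)) 𝟘 𝟙)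
  blocks𝟘𝟙-meetIrr a 𝟙-irr@(_ , _ , (c₁ , c₁⋖𝟙 , _)) = irreducible
    where
    open LastZero a 𝟙
    z-last : ∀ z → v ⊏ z → z ! last ≡ 𝟙
    z-last z v⊏z = ≤-antisym (𝟙-greatest _) (subst (_≤P z ! last) v-last (proj₁ v⊏z last))
    z-i₀ : ∀ z → InQ z → v ⊏ z → z ! i₀ ≡ 𝟙 ⊎ (z ! i₀ ≡ c₁ × z ! i₀ ≢ 𝟘)
    z-i₀ z z∈Q v⊏z with z ! i₀ ≟ 𝟙
    ... | yes e = inj₁ e
    ... | no zᵢ₀≢𝟙 = cover (distinct-nonzero⇒⋖ {z} z∈Q i₀ last (above-nonzero-at-i₀ refl z∈Q v⊏z) z-last≢𝟘
                           (λ e → zᵢ₀≢𝟙 (trans e (z-last z v⊏z))))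
      where
      z-last≢𝟘 : z ! last ≢ 𝟘
      z-last≢𝟘 e = above-nonzero-at-i₀ refl z∈Q v⊏z
        (≤-antisym (subst (z ! i₀ ≤P_) e (proj₁ z∈Q i₀ last (ℕ.<⇒≤ i₀<last))) (𝟘-least _))
      cover : z ! i₀ ⋖ z ! last ⊎ z ! last ⋖ z ! i₀ → z ! i₀ ≡ 𝟙 ⊎ (z ! i₀ ≡ c₁ × z ! i₀ ≢ 𝟘)
      cover (inj₁ zᵢ₀⋖z-last) =
        inj₂ (joinIrr-cover-unique 𝟙-irr (subst (z ! i₀ ⋖_) (z-last z v⊏z) zᵢ₀⋖z-last) c₁⋖𝟙 , above-nonzero-at-i₀ refl z∈Q v⊏z)
      cover (inj₂ z-last⋖zᵢ₀) = ⊥-elim (≺⇒≱ (subst (_≺P z ! i₀) (z-last z v⊏z) (⋖⇒≺ z-last⋖zᵢ₀)) (𝟙-greatest _))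
    irreducible : MeetIrr Q v
    irreducible with c₁ ≟ 𝟘
    ... | yes c₁≡𝟘 = meetIrr-intro (raise-to-p (subst (_⋖ 𝟙) c₁≡𝟘 c₁⋖𝟙)) least
      where
      least : ∀ z → v ⋖Q z → w 𝟙 ⊑ z
      least z (_ , z∈Q , v⊏z , _) with z-i₀ z z∈Q v⊏z
      ... | inj₁ zᵢ₀≡𝟙 = update-⊑ {v} {z} i₀ 𝟙 (proj₁ v⊏z) (subst (𝟙 ≤P_) (sym zᵢ₀≡𝟙) (≤-refl 𝟙))
      ... | inj₂ (zᵢ₀≡c₁ , zᵢ₀≢𝟘) = ⊥-elim (zᵢ₀≢𝟘 (trans zᵢ₀≡c₁ c₁≡𝟘))
    ... | no c₁≢𝟘 = meetIrr-intro (raise c₁⋖𝟙 c₁≢𝟘) least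
      where
      least : ∀ z → v ⋖Q z → w c₁ ⊑ z
      least z (_ , z∈Q , v⊏z , _) with z-i₀ z z∈Q v⊏z
      ... | inj₁ zᵢ₀≡𝟙 = update-⊑ {v} {z} i₀ c₁ (proj₁ v⊏z) (subst (c₁ ≤P_) (sym zᵢ₀≡𝟙) (𝟙-greatest c₁))
      ... | inj₂ (zᵢ₀≡c₁ , _) = update-⊑ {v} {z} i₀ c₁ (proj₁ v⊏z) (subst (c₁ ≤P_) (sym zᵢ₀≡c₁) (≤-refl c₁))

  UpperCoverBlocks : V → Set
  UpperCoverBlocks v = ∃[ x ] ∃[ a ] ((MeetIrr SP x × x ≢ 𝟘) × v ≡ blocks (suc (toℕ {m} a)) x (upperCover x))

  ZeroConstant : V → Set
  ZeroConstant v = ∃[ x ] ((MeetIrr SP x × x ≡ 𝟘) × v ≡ constant x)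

  ZeroTopBlocks : V → Set
  ZeroTopBlocks v = ∃[ x ] ∃[ a ] ((JoinIrr SP x × x ≡ 𝟙) × v ≡ blocks (suc (toℕ {n} a)) 𝟘 x)

  leading-zero-¬meetIrr : ∀ {v p q} → InQ v → p ⋖ q → p ≢ 𝟘 → (shape : PairShape v p q) →
                          0 < toℕ (PairShape.ia shape) → ¬ MeetIrr Q v
  leading-zero-¬meetIrr {v} {p} {q} v∈Q p⋖q p≢𝟘 shape 0<ia (_ , _ , (_ , _ , only)) = p≢𝟘 (begin
    p                                        ≡⟨ sym (update-here v (last-𝟘 0<ia) p) ⟩
    (v [ last-𝟘 0<ia ]≔ p) ! last-𝟘 0<ia     ≡⟨ cong (_! last-𝟘 0<ia) (trans (only _ (raise-last-𝟘 0<ia)) (sym (only _ raise-last-p))) ⟩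
    (v [ last-p ]≔ q) ! last-𝟘 0<ia          ≡⟨ update-elsewhere v last-p q (last-𝟘 0<ia) last-𝟘≢last-p ⟩
    v ! last-𝟘 0<ia                          ≡⟨ v-last-𝟘 0<ia ⟩
    𝟘                                        ∎)
    where
    open PairShape shape using (ia)
    open PairShapeMoves v∈Q p⋖q p≢𝟘 shape
    last-𝟘≢last-p : last-𝟘 0<ia ≢ last-p
    last-𝟘≢last-p e = ℕ.<-irrefl (cong toℕ e) (ℕ.<-≤-trans (previous< ia 0<ia) ia≤last-p)

  -- Were r ≠ q another upper cover of p, walking up a maximal chain from r to 𝟙 yields t ⋖ t′
  -- with q ≰ t and q ≤ t′; then t^(ib) t′^(m−ib) lies strictly above v = p^(ib) q^(m−ib)
  -- but not above its upper cover obtained by raising the last p.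
  no-leading-zero-meetIrr⇒meetIrr : ∀ {v p q} → InQ v → p ⋖ q → p ≢ 𝟘 → (shape : PairShape v p q) →
                                    toℕ (PairShape.ia shape) ≡ 0 → MeetIrr Q v → MeetIrr SP p
  no-leading-zero-meetIrr⇒meetIrr {v} {p} {q} v∈Q p⋖q p≢𝟘 shape ia≡0 (_ , _ , (_ , _ , only)) =
    tt , (λ maximal → proj₂ maximal q tt (⋖⇒≺ p⋖q)) , (q , p⋖q , unique)
    where
    open PairShape shape
    open PairShapeMoves v∈Q p⋖q p≢𝟘 shape
    only-q : ∀ r → p ⋖ r → r ≢ q → ⊥
    only-q r p⋖r r≢q with crossing-below𝟙 {r} {q} (λ q≤r → ⋖-nothing-between p⋖r (⋖⇒≺ p⋖q) (q≤r , λ e → r≢q (sym e)))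
    ... | t , t′ , r≤t , q≰t , t⋖t′ , q≤t′ =
      ¬¬coverQ-above v W v∈Q (blocks-inQ t⋖t′) (v⊑W , v≢W)
        (λ d v⋖d d⊑W → raised⋢W (subst (_⊑ W) (trans (only d v⋖d) (sym (only _ raise-last-p))) d⊑W))
      where
      W : V
      W = blocks (toℕ ib) t t′
      v⊑W : v ⊑ W
      v⊑W l with blocks-view (toℕ ib) t t′ l
      ... | inj₁ (l<ib , e) = subst₂ _≤P_ (sym (is-p l (subst (_≤ toℕ l) (sym ia≡0) z≤n) l<ib)) (sym e)
                                     (≤-trans (proj₁ (⋖⇒≺ p⋖r)) r≤t)
      ... | inj₂ (ib≤l , e) = subst₂ _≤P_ (sym (is-q l ib≤l)) (sym e) q≤t′
      W-last-p : W ! last-p ≡ t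
      W-last-p = blocks-< last-p (previous< ib 0<ib)
      v≢W : v ≢ W
      v≢W e = ≺⇒≱ (⋖⇒≺ p⋖r) (subst (r ≤P_) (sym (trans (sym v-last-p) (trans (cong (_! last-p) e) W-last-p))) r≤t)
      raised⋢W : ¬ ((v [ last-p ]≔ q) ⊑ W)
      raised⋢W raised⊑W = q≰t (subst₂ _≤P_ (update-here v last-p q) W-last-p (raised⊑W last-p))
    unique : ∀ r → p ⋖ r → r ≡ q
    unique r p⋖r with r ≟ q
    ... | yes r≡q = r≡q
    ... | no r≢q = ⊥-elim (only-q r p⋖r r≢q)

  no-leading-zero-meetIrr : ∀ {v p q} → InQ v → p ⋖ q → p ≢ 𝟘 → (shape : PairShape v p q) →
                            toℕ (PairShape.ia shape) ≡ 0 → MeetIrr Q v → UpperCoverBlocks v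
  no-leading-zero-meetIrr {v} {p} {q} v∈Q p⋖q p≢𝟘 shape ia≡0 v-irr = p , last-p , (p-irr , p≢𝟘) , vec-ext _ _ agree
    where
    open PairShape shape
    open PairShapeMoves v∈Q p⋖q p≢𝟘 shape
    p-irr : MeetIrr SP p
    p-irr = no-leading-zero-meetIrr⇒meetIrr v∈Q p⋖q p≢𝟘 shape ia≡0 v-irr
    agree : ∀ l → v ! l ≡ blocks (suc (toℕ last-p)) p (upperCover p) ! l
    agree l with blocks-view (suc (toℕ last-p)) p (upperCover p) l
    ... | inj₁ (l<ib , e) = trans (is-p l (subst (_≤ toℕ l) (sym ia≡0) z≤n) (subst (toℕ l <_) (suc-previous ib 0<ib) l<ib)) (sym e)
    ... | inj₂ (ib≤l , e) = trans (is-q l (subst (_≤ toℕ l) (suc-previous ib 0<ib) ib≤l))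
                                  (trans (meetIrr-cover-unique p-irr p⋖q (upperCover-⋖ p-irr)) (sym e))

  zero-top-meetIrr⇒joinIrr : ∀ (a : Fin n) → 𝟙 ≢ 𝟘 → MeetIrr Q (blocks (suc (toℕ a)) 𝟘 𝟙) → JoinIrr SP 𝟙
  zero-top-meetIrr⇒joinIrr a 𝟙≢𝟘 (_ , _ , (_ , _ , only)) with cover-below (𝟘≺ 𝟙≢𝟘)
  ... | c₁ , _ , c₁⋖𝟙 = tt , (λ minimal → proj₂ minimal 𝟘 tt (𝟘≺ 𝟙≢𝟘)) , (c₁ , c₁⋖𝟙 , unique)
    where
    open LastZero a 𝟙
    unique : ∀ c → c ⋖ 𝟙 → c ≡ c₁
    unique c c⋖𝟙 with c ≟ 𝟘 | c₁ ≟ 𝟘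
    ... | yes c≡𝟘 | yes c₁≡𝟘 = trans c≡𝟘 (sym c₁≡𝟘)
    ... | yes c≡𝟘 | no c₁≢𝟘 = ⊥-elim (⋖-nothing-between (subst (_⋖ 𝟙) c≡𝟘 c⋖𝟙) (𝟘≺ c₁≢𝟘) (⋖⇒≺ c₁⋖𝟙))
    ... | no c≢𝟘 | yes c₁≡𝟘 = ⊥-elim (⋖-nothing-between (subst (_⋖ 𝟙) c₁≡𝟘 c₁⋖𝟙) (𝟘≺ c≢𝟘) (⋖⇒≺ c⋖𝟙))
    ... | no c≢𝟘 | no c₁≢𝟘 =
      trans (sym (update-here v i₀ c))
            (trans (cong (_! i₀) (trans (only _ (raise c⋖𝟙 c≢𝟘)) (sym (only _ (raise c₁⋖𝟙 c₁≢𝟘)))))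
                   (update-here v i₀ c₁))

  -- For p ≠ 𝟙 one can raise either coordinate i₀ or the last coordinate.
  zero-prefix-below𝟙-¬meetIrr : ∀ (a : Fin n) p → p ≢ 𝟘 → p ≢ 𝟙 → ¬ MeetIrr Q (blocks (suc (toℕ a)) 𝟘 p)
  zero-prefix-below𝟙-¬meetIrr a p p≢𝟘 p≢𝟙 (_ , _ , (_ , _ , only)) with cover-above (𝟙-greatest p , p≢𝟙) | raise-to-lower-cover p≢𝟘
    where open LastZero a p
  ... | q , p⋖q , _ | c , v⋖w = proj₂ (⋖⇒≺ p⋖q) (begin
    p                  ≡⟨ sym v-last ⟩
    v ! last           ≡⟨ sym (update-elsewhere v i₀ c last last≢i₀) ⟩
    w c ! last         ≡⟨ cong (_! last) (trans (only _ v⋖w) (sym (only _ v⋖U))) ⟩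
    (v [ last ]≔ q) ! last ≡⟨ update-here v last q ⟩
    q                  ∎)
    where
    open LastZero a p
    v⋖U : v ⋖Q (v [ last ]≔ q)
    v⋖U = raise-last v∈Q p⋖q v-last (λ l → [ inj₁ , inj₂ ∘ inj₁ ]′ (blocks-values l))

  zero-prefix-meetIrr : ∀ (a : Fin n) p → p ≢ 𝟘 → MeetIrr Q (blocks (suc (toℕ a)) 𝟘 p) →
                        ZeroTopBlocks (blocks (suc (toℕ a)) 𝟘 p)
  zero-prefix-meetIrr a p p≢𝟘 v-irr with p ≟ 𝟙
  ... | yes refl = 𝟙 , a , (zero-top-meetIrr⇒joinIrr a p≢𝟘 v-irr , refl) , refl
  ... | no p≢𝟙 = ⊥-elim (zero-prefix-below𝟙-¬meetIrr a p p≢𝟘 p≢𝟙 v-irr)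

  meetIrrQ-shape : ∀ {v} → MeetIrr Q v → UpperCoverBlocks v ⊎ ZeroConstant v ⊎ ZeroTopBlocks v
  meetIrrQ-shape {v} v-irr@(v∈Q , _ , _) with coverCond-view {v} (proj₂ v∈Q)
  ... | allZero all-𝟘 = inj₂ (inj₁ (𝟘 , (meetIrr-of-constant 𝟘 (subst (MeetIrr Q) v≡ v-irr) , refl) , v≡))
    where v≡ : v ≡ constant 𝟘
          v≡ = vec-ext _ _ (λ i → trans (all-𝟘 i) (sym (constant-lookup 𝟘 i)))
  ... | oneValue p p≢𝟘 p∈v values with oneValue-shape {v} p v∈Q p≢𝟘 p∈v values
  ... | Fin.zero , v≡ = inj₁ (p , last , (meetIrr-of-constant p (subst (MeetIrr Q) v≡constant v-irr) , p≢𝟘) , v≡blocks)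
    where
    v≡constant : v ≡ constant p
    v≡constant = trans v≡ (vec-ext _ _ (λ i → trans (blocks-≥ {0} {𝟘} {p} i z≤n) (sym (constant-lookup p i))))
    v≡blocks : v ≡ blocks (suc (toℕ last)) p (upperCover p)
    v≡blocks = trans v≡constant (vec-ext _ _ (λ i → trans (constant-lookup p i) (sym (blocks-< i (s≤s (≤-last i))))))
  ... | Fin.suc a , v≡ = inj₂ (inj₂ (subst ZeroTopBlocks (sym v≡) (zero-prefix-meetIrr a p p≢𝟘 (subst (MeetIrr Q) v≡ v-irr))))
  meetIrrQ-shape {v} v-irr@(v∈Q , _ , _) | twoValues p q p⋖q p≢𝟘 p∈v q∈v values
    with twoValues-shape {v} p q v∈Q p⋖q p≢𝟘 p∈v q∈v values
  ... | shape with toℕ (PairShape.ia shape) ℕ.≟ 0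
  ... | yes ia≡0 = inj₁ (no-leading-zero-meetIrr v∈Q p⋖q p≢𝟘 shape ia≡0 v-irr)
  ... | no ia≢0 = ⊥-elim (leading-zero-¬meetIrr v∈Q p⋖q p≢𝟘 shape (ℕ.n≢0⇒n>0 ia≢0) v-irr)

  upperCoverBlocks-injective : ∀ {x x′} {a a′ : Fin m} → MeetIrr SP x × x ≢ 𝟘 → MeetIrr SP x′ × x′ ≢ 𝟘 →
    blocks (suc (toℕ a)) x (upperCover x) ≡ blocks (suc (toℕ a′)) x′ (upperCover x′) → x ≡ x′ × a ≡ a′
  upperCoverBlocks-injective {x} {x′} {a} {a′} (x-irr , _) (x′-irr , _) eq = x≡x′ , Fin.toℕ-injective a≡a′
    where
    first : ∀ {y z} (b : Fin m) → blocks (suc (toℕ b)) y z ! Fin.zero ≡ y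
    first {y} {z} b = blocks-< {suc (toℕ b)} {y} {z} Fin.zero (s≤s z≤n)
    x≡x′ : x ≡ x′
    x≡x′ = trans (sym (first {x} {upperCover x} a)) (trans (cong (_! Fin.zero) eq) (first {x′} {upperCover x′} a′))
    a≡a′ : toℕ a ≡ toℕ a′
    a≡a′ with ℕ.<-cmp (toℕ a) (toℕ a′)
    ... | tri≈ _ e _ = e
    ... | tri< a<a′ _ _ = ⊥-elim (proj₂ (⋖⇒≺ (upperCover-⋖ x-irr))
          (sym (trans (sym (blocks-≥ a′ a<a′)) (trans (cong (_! a′) eq) (trans (blocks-< a′ (ℕ.n<1+n _)) (sym x≡x′))))))
    ... | tri> _ _ a′<a = ⊥-elim (proj₂ (⋖⇒≺ (upperCover-⋖ x′-irr))
          (sym (trans (sym (blocks-≥ a a′<a)) (trans (cong (_! a) (sym eq)) (trans (blocks-< a (ℕ.n<1+n _)) x≡x′)))))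

  zeroTopBlocks-injective : ∀ {x x′} {a a′ : Fin n} → JoinIrr SP x × x ≡ 𝟙 → JoinIrr SP x′ × x′ ≡ 𝟙 →
    blocks (suc (toℕ a)) 𝟘 x ≡ blocks (suc (toℕ a′)) 𝟘 x′ → x ≡ x′ × a ≡ a′
  zeroTopBlocks-injective {a = a} {a′} (x-irr , x≡𝟙) (x′-irr , x′≡𝟙) eq with blocks𝟘-injective {a = Fin.suc a} {Fin.suc a′} x-irr x′-irr eq
  ... | x≡x′ , refl = x≡x′ , refl

  constant-injective : ∀ {x y} → constant x ≡ constant y → x ≡ y
  constant-injective {x} {y} eq = trans (sym (constant-lookup x Fin.zero)) (trans (cong (_! Fin.zero) eq) (constant-lookup y Fin.zero))

  private
    rearrange : ∀ c₁ χ₀ χ₁ → c₁ * m + (χ₀ + χ₁ * n) + n * χ₀ ≡ m * (c₁ + χ₀) + n * χ₁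
    rearrange c₁ χ₀ χ₁ = solve-∀′ c₁ χ₀ χ₁ n
      where solve-∀′ : ∀ c₁ χ₀ χ₁ n → c₁ * suc n + (χ₀ + χ₁ * n) + n * χ₀ ≡ suc n * (c₁ + χ₀) + n * χ₁
            solve-∀′ = solve-∀

  -- |M(Q)| = m·(|M(P)| − [𝟘 ∈ M(P)]) + [𝟘 ∈ M(P)] + n·[𝟙 ∈ J(P)], stated without subtraction.
  hasCard-meetIrr-mcover : ∀ {k} → HasCard (MeetIrr SP) k → (d₀ : Dec (MeetIrr SP 𝟘)) (d₁ : Dec (JoinIrr SP 𝟙)) →
    ∃[ c ] (HasCard (MeetIrr Q) c × c + n * indicator d₀ ≡ m * k + n * indicator d₁)
  hasCard-meetIrr-mcover card d₀ d₁ with hasCard-remove _≟_ 𝟘 d₀ card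
  ... | c₁ , nonzero-card , refl =
    _ , hasCard-cong (λ _ → join) (λ _ → meetIrrQ-shape)
          (hasCard-⊎ (hasCard-image₂ (λ x a → blocks (suc (toℕ a)) x (upperCover x)) upperCoverBlocks-injective nonzero-card)
            (hasCard-⊎ (hasCard-image constant (λ _ _ → constant-injective) (hasCard-at 𝟘 d₀))
                       (hasCard-image₂ (λ x a → blocks (suc (toℕ a)) 𝟘 x) zeroTopBlocks-injective (hasCard-at 𝟙 d₁))
                       zero≠top)
            nonzero≠others) ,
    rearrange c₁ (indicator d₀) (indicator d₁)
    where
    join : ∀ {v} → UpperCoverBlocks v ⊎ ZeroConstant v ⊎ ZeroTopBlocks v → MeetIrr Q v
    join (inj₁ (x , a , (x-irr , x≢𝟘) , refl)) = blocks-upperCover-meetIrr x a x-irr x≢𝟘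
    join (inj₂ (inj₁ (_ , (𝟘-irr , refl) , refl))) = constant𝟘-meetIrr 𝟘-irr
    join (inj₂ (inj₂ (_ , a , (𝟙-irr , refl) , refl))) = blocks𝟘𝟙-meetIrr a 𝟙-irr
    zero≠top : ∀ v → ZeroConstant v → ¬ ZeroTopBlocks v
    zero≠top v (_ , (_ , refl) , refl) (x , a , (x-irr , _) , eq) =
      joinIrr⇒≢𝟘 x-irr (trans (sym (blocks-≥ last (subst (suc (toℕ a) ≤_) (sym toℕ-last) (Fin.toℕ<n a))))
                              (trans (cong (_! last) (sym eq)) (constant-lookup 𝟘 last)))
    nonzero≠others : ∀ v → UpperCoverBlocks v → ¬ (ZeroConstant v ⊎ ZeroTopBlocks v)
    nonzero≠others v (x , a , (_ , x≢𝟘) , refl) (inj₁ (_ , (_ , refl) , eq)) =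
      x≢𝟘 (trans (sym (blocks-< {suc (toℕ a)} {x} {upperCover x} Fin.zero (s≤s z≤n)))
                 (trans (cong (_! Fin.zero) eq) (constant-lookup 𝟘 Fin.zero)))
    nonzero≠others v (x , a , (_ , x≢𝟘) , refl) (inj₂ (y , a′ , _ , eq)) =
      x≢𝟘 (trans (sym (blocks-< {suc (toℕ a)} {x} {upperCover x} Fin.zero (s≤s z≤n)))
                 (trans (cong (_! Fin.zero) eq) (blocks-< {suc (toℕ a′)} {𝟘} {y} Fin.zero (s≤s z≤n))))

module _ (P : FinBoundedPoset) where
  open FinBoundedPoset P
  open FinitePoset P

  mcover-extremal⇔ : ∀ {k} n → HasLength SP k → HasCard (JoinIrr SP) k → HasCard (MeetIrr SP) k →
    (d₀ : Dec (MeetIrr SP 𝟘)) (d₁ : Dec (JoinIrr SP 𝟙)) →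
    Extremal (MCover P (suc n)) ⇔ (n * indicator d₀ ≡ n * indicator d₁)
  mcover-extremal⇔ {k} n hasLength cardJ cardM d₀ d₁ with MeetIrreducibles.hasCard-meetIrr-mcover P n cardM d₀ d₁
  ... | c , cardMQ , count = mk⇔ necessary sufficient
    where
    open MCoverPoset P n using (hasLength-mcover)
    open JoinIrreducibles P n using (hasCard-joinIrr-mcover)
    necessary : Extremal (MCover P (suc n)) → n * indicator d₀ ≡ n * indicator d₁
    necessary (K , hasLengthQ , _ , cardMQ′) = ℕ.+-cancelˡ-≡ (suc n * k) _ _ (begin
      suc n * k + n * indicator d₀ ≡⟨ cong (_+ n * indicator d₀) mk≡K ⟩
      K + n * indicator d₀         ≡⟨ cong (_+ n * indicator d₀) (hasCard-unique cardMQ′ cardMQ) ⟩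
      c + n * indicator d₀         ≡⟨ count ⟩
      suc n * k + n * indicator d₁ ∎)
      where mk≡K : suc n * k ≡ K
            mk≡K = hasLength-unique (MCover P (suc n)) (hasLength-mcover hasLength) hasLengthQ
    sufficient : n * indicator d₀ ≡ n * indicator d₁ → Extremal (MCover P (suc n))
    sufficient agree = suc n * k , hasLength-mcover hasLength , hasCard-joinIrr-mcover cardJ ,
      subst (HasCard _) (ℕ.+-cancelʳ-≡ (n * indicator d₀) c (suc n * k) c+nχ₀≡mk+nχ₀) cardMQ
      where c+nχ₀≡mk+nχ₀ : c + n * indicator d₀ ≡ suc n * k + n * indicator d₀
            c+nχ₀≡mk+nχ₀ = trans count (cong (suc n * k +_) (sym agree))

corollary2p3 : (P : FinBoundedPoset) (k : ℕ)
    → Extremal (asSub P) → HasLength (asSub P) k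
    → ((∀ (m : ℕ) → m > 0 → Extremal (MCover P m))
       ⇔ ((MeetIrr (asSub P) (FinBoundedPoset.𝟘 P) × JoinIrr (asSub P) (FinBoundedPoset.𝟙 P))
          ⊎ (¬ MeetIrr (asSub P) (FinBoundedPoset.𝟘 P) × ¬ JoinIrr (asSub P) (FinBoundedPoset.𝟙 P))))
corollary2p3 P k (k₀ , hasLength₀ , cardJ₀ , cardM₀) hasLength = mk⇔ necessary sufficient
  where
  open FinBoundedPoset P
  open FinitePoset P using (SP)
  cardJ : HasCard (JoinIrr SP) k
  cardJ = subst (HasCard (JoinIrr SP)) (hasLength-unique SP hasLength₀ hasLength) cardJ₀
  cardM : HasCard (MeetIrr SP) k
  cardM = subst (HasCard (MeetIrr SP)) (hasLength-unique SP hasLength₀ hasLength) cardM₀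
  d₀ : Dec (MeetIrr SP 𝟘)
  d₀ = hasCard-dec _≟_ cardM 𝟘
  d₁ : Dec (JoinIrr SP 𝟙)
  d₁ = hasCard-dec _≟_ cardJ 𝟙
  extremal⇔ : ∀ n → Extremal (MCover P (suc n)) ⇔ (n * indicator d₀ ≡ n * indicator d₁)
  extremal⇔ n = mcover-extremal⇔ P n hasLength cardJ cardM d₀ d₁
  BothOrNeither : Set
  BothOrNeither = (MeetIrr SP 𝟘 × JoinIrr SP 𝟙) ⊎ (¬ MeetIrr SP 𝟘 × ¬ JoinIrr SP 𝟙)
  necessary : (∀ m → m > 0 → Extremal (MCover P m)) → BothOrNeither
  necessary extremal = indicator-≡⇒both-or-neither d₀ d₁
    (ℕ.*-cancelˡ-≡ _ _ 1 (Equivalence.to (extremal⇔ 1) (extremal 2 (s≤s z≤n))))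
  sufficient : BothOrNeither → ∀ m → m > 0 → Extremal (MCover P m)
  sufficient condition (suc n) _ =
    Equivalence.from (extremal⇔ n) (cong (n *_) (both-or-neither⇒indicator-≡ d₀ d₁ condition))
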